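{- Let $n$ be a positive integer. For each positive divisor $d$ of $n$ define $$Z(d,1)=\sum_{d'}\frac{\varphi(d'd)}{(d'd)^{2}},$$ where $d'$ ranges over the positive integers all of whose prime factors $p$ satisfy $p\mid d$ and $p\nmid n/d$ (including $d'=1$), and $\varphi$ is Euler's totient function; and set $R(n,d)=Z(d,1)\prod_{p\mid n}(1+1/p)^{ -1}$, the product over primes dividing $n$. Then $\sum_{d\mid n}R(n,d)=1$. -}

module Defs where

open import Data.Nat as ℕ using (ℕ; zero; suc; _≤_; _*_)
open import Data.Nat.Divisibility using (_∣?_; _∣_)
open import Data.Nat.DivMod using (_/_)
open import Data.Nat.Coprimality using (coprime?)
open import Data.Nat.Primality using (Prime; prime?)
open import Data.List using (List; []; _∷_; filter; length; map; foldr)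
open import Data.List.Relation.Unary.All using (All)
open import Data.Integer using (+_)
open import Data.Rational as ℚ using (ℚ; _<_; _-_; ∣_∣; 0ℚ; 1ℚ)
open import Data.Product using (∃)
open import Relation.Nullary using (¬_)
open import Relation.Nullary.Decidable using (_×-dec_; ¬?)
open import Relation.Unary using (Decidable)

range1 : ℕ → List ℕ
range1 zero    = []
range1 (suc m) = range1 m Data.List.++ (suc m ∷ [])

φ : ℕ → ℕ
φ m = length (filter (λ k → coprime? k m) (range1 m))

divisors : ℕ → List ℕ
divisors n = filter (λ d → d ∣? n) (range1 n)

-- primes dividing m (m ≥ 1)
primeDivisors : ℕ → List ℕ
primeDivisors m = filter (λ p → prime? p ×-dec (p ∣? m)) (range1 m)

sumℚ : List ℚ → ℚ
sumℚ = foldr ℚ._+_ 0ℚ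

prodℚ : List ℚ → ℚ
prodℚ = foldr ℚ._*_ 1ℚ

Admissible : ℕ → (d : ℕ) → .{{_ : ℕ.NonZero d}} → ℕ → Set
Admissible n d d' = All (λ p → (p ∣ d) Data.Product.× ¬ (p ∣ (n / d))) (primeDivisors d')

admissible? : ∀ n d .{{_ : ℕ.NonZero d}} → Decidable (Admissible n d)
admissible? n d d' = Data.List.Relation.Unary.All.all? (λ p → (p ∣? d) ×-dec ¬? (p ∣? (n / d))) (primeDivisors d')

term : ℕ → ℚ
term zero    = 0ℚ
term (suc k) = (+ φ (suc k)) ℚ./ (suc k * suc k)

-- N-th partial sum of Z(d,1): sum over admissible d' with 1 ≤ d' ≤ N
-- of φ(d'd)/(d'd)².  (Only used for d ≥ 1.)
Zpartial : ℕ → ℕ → ℕ → ℚ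
Zpartial n zero    N = 0ℚ
Zpartial n (suc k) N =
  sumℚ (map (λ d' → term (d' * suc k))
            (filter (admissible? n (suc k)) (range1 N)))

-- ∏_{p ∣ n} (1 + 1/p)^{-1} = ∏_{p ∣ n} p/(p+1)
eulerFactor : ℕ → ℚ
eulerFactor n = prodℚ (map (λ p → (+ p) ℚ./ suc p) (primeDivisors n))

-- N-th partial sum of Σ_{d ∣ n} R(n,d)
Rpartial : ℕ → ℕ → ℚ
Rpartial n N = sumℚ (map (λ d → Zpartial n d N ℚ.* eulerFactor n) (divisors n))

ConvergesTo : (ℕ → ℚ) → ℚ → Set
ConvergesTo s L = (ε : ℚ) → 0ℚ < ε → ∃ λ N → (M : ℕ) → N ≤ M → ∣ s M - L ∣ < ε

-- Every m all of whose prime factors divide n factors uniquely as m = d′d with d ∣ n and d′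
-- admissible for (n, d), namely with d = gcd(m, n); conversely every such d′d has its prime
-- factors among those of n. So Σ_{d ∣ n} Z(d,1) is the sum of φ(m)/m² over the m supported on the
-- primes of n, and its N-th partial sum lies between the partial sums of that series up to N and
-- up to Nn. The series is the Euler product ∏_{p ∣ n} (1 + 1/p): adding a prime p to the allowed
-- set adds the sum V of the terms with p ∣ m, and as φ(jp)/(jp)² is φ(j)/j² times 1/p if p ∣ j and
-- times φ(p)/p² otherwise, V(Np) = V(N)/p + φ(p)/p² · A(N) for the old partial sums A. Since
-- φ(p)/p² + 1/p² = 1/p, iterating this identity pins the supremum of V down to 1/p times that of A.

module Submission where

open import Level using (0ℓ)
open import Algebra.Bundles using (CommutativeMonoid)
open import Algebra.Core using (Op₂)
open import Algebra.Structures using (IsCommutativeMonoid)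
import Algebra.Properties.CommutativeSemigroup as CommutativeSemigroupProperties
open import Data.Nat as ℕ using (ℕ; zero; suc; _≥_; z≤n; s≤s)
import Data.Nat.Properties as ℕP
open import Data.Nat.Divisibility using (_∣_; _∣?_; ∣m+n∣m⇒∣n; n∣m*n; m∣m*n; ∣n⇒∣m*n; ∣⇒≤; ∣-trans; ∣m∣n⇒∣m+n; ∣1⇒≡1; ∣m⇒∣m*n; 0∣⇒≡0)
open import Data.Nat.Coprimality as Coprimality using (Coprime; coprime?; coprime-divisor; coprime⇒gcd≡1; gcd≡1⇒coprime)
open import Data.Nat.DivMod using (m/n*n≡m; m*n/n≡m; m≥n⇒m/n>0)
open import Data.Nat.GCD using (gcd; gcd[m,n]∣m; gcd[m,n]∣n; gcd[m,n]≤n; gcd-greatest; c*gcd[m,n]≡gcd[cm,cn])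
open import Data.Nat.Primality using (Prime; prime?; euclidsLemma; prime⇒irreducible; prime⇒nonZero; prime⇒nonTrivial; ¬prime[0]; ¬prime[1])
open import Data.Nat.Primality.Factorisation using (factorise)
open import Data.Nat.ListAction using (product)
open import Data.Integer as ℤ using (+_)
import Data.Integer.Properties as ℤP
open import Data.Rational as ℚ using (ℚ; mkℚ; _+_; _*_; _-_; -_; _/_; _≤_; _<_; 0ℚ; 1ℚ; toℚᵘ)
import Data.Rational.Properties as ℚP
open import Data.Rational.Solver using (module +-*-Solver)
open import Data.Rational.Unnormalised as ℚᵘ using (ℚᵘ; mkℚᵘ; *≡*; *≤*; *<*)
import Data.Rational.Unnormalised.Properties as ℚᵘP
open import Data.List using (List; []; _∷_; _++_; map; filter; length)
import Data.List.Properties as ListP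
open import Data.List.Membership.Propositional using (_∈_; _∉_)
open import Data.List.Membership.DecPropositional ℕ._≟_ using (_∈?_)
open import Data.List.Membership.Propositional.Properties using (∈-++⁺ˡ; ∈-++⁺ʳ; ∈-++⁻; ∈-filter⁺; ∈-filter⁻)
open import Data.List.Relation.Unary.All as All using (All; []; _∷_)
open import Data.List.Relation.Unary.All.Properties using (All¬⇒¬Any)
open import Data.List.Relation.Unary.Any using (here; there)
open import Data.List.Relation.Unary.Unique.Propositional using (Unique; []; _∷_)
import Data.List.Relation.Unary.Unique.Propositional.Properties as UniqueP
open import Data.Product using (_×_; _,_; proj₁; proj₂; ∃)
open import Data.Sum using (_⊎_; inj₁; inj₂)
open import Function using (_∘_)
open import Relation.Nullary using (Dec; yes; no; ¬_)
open import Relation.Nullary.Negation using (contradiction)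
open import Relation.Nullary.Decidable using (_×-dec_; ¬?)
open import Relation.Unary using (Decidable)
open import Relation.Binary.Definitions using (DecidableEquality)
open import Relation.Binary.PropositionalEquality

open import Defs

∈-range1⁻ : ∀ {k} m → k ∈ range1 m → 1 ℕ.≤ k × k ℕ.≤ m
∈-range1⁻ (suc m) k∈ with ∈-range1⁻ m | ∈-++⁻ (range1 m) k∈
... | ih | inj₁ k∈m = proj₁ (ih k∈m) , ℕP.m≤n⇒m≤1+n (proj₂ (ih k∈m))
... | _  | inj₂ (here refl) = s≤s z≤n , ℕP.≤-refl

∈-range1⁺ : ∀ {k} m → 1 ℕ.≤ k → k ℕ.≤ m → k ∈ range1 m
∈-range1⁺ zero (s≤s _) ()
∈-range1⁺ {k} (suc m) 1≤k k≤1+m with k ℕ.≟ suc m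
... | yes refl = ∈-++⁺ʳ (range1 m) (here refl)
... | no k≢1+m = ∈-++⁺ˡ (∈-range1⁺ m 1≤k (ℕP.≤-pred (ℕP.≤∧≢⇒< k≤1+m k≢1+m)))

range1-+ : ∀ a b → range1 (a ℕ.+ b) ≡ range1 a ++ map (a ℕ.+_) (range1 b)
range1-+ a zero = trans (cong range1 (ℕP.+-identityʳ a)) (sym (ListP.++-identityʳ (range1 a)))
range1-+ a (suc b) = begin
  range1 (a ℕ.+ suc b)                                  ≡⟨ cong range1 (ℕP.+-suc a b) ⟩
  range1 (a ℕ.+ b) ++ (suc (a ℕ.+ b) ∷ [])              ≡⟨ cong (_++ (suc (a ℕ.+ b) ∷ [])) (range1-+ a b) ⟩
  (range1 a ++ map (a ℕ.+_) (range1 b)) ++ (suc (a ℕ.+ b) ∷ [])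
    ≡⟨ ListP.++-assoc (range1 a) _ _ ⟩
  range1 a ++ (map (a ℕ.+_) (range1 b) ++ (suc (a ℕ.+ b) ∷ []))
    ≡⟨ cong (λ x → range1 a ++ (map (a ℕ.+_) (range1 b) ++ (x ∷ []))) (sym (ℕP.+-suc a b)) ⟩
  range1 a ++ (map (a ℕ.+_) (range1 b) ++ map (a ℕ.+_) (suc b ∷ []))
    ≡⟨ cong (range1 a ++_) (sym (ListP.map-++ (a ℕ.+_) (range1 b) _)) ⟩
  range1 a ++ map (a ℕ.+_) (range1 (suc b))             ∎
  where open ≡-Reasoning

range1-unique : ∀ m → Unique (range1 m)
range1-unique zero = []
range1-unique (suc m) = UniqueP.++⁺ (range1-unique m) ([] ∷ []) last∉
  where
  last∉ : ∀ {k} → ¬ (k ∈ range1 m × k ∈ suc m ∷ [])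
  last∉ (k∈ , here refl) = ℕP.<-irrefl refl (s≤s (proj₂ (∈-range1⁻ m k∈)))

module ListSum {A : Set} {_⊕_ : Op₂ A} {ε : A}
                (isCommutativeMonoid : IsCommutativeMonoid _≡_ _⊕_ ε) where

  open IsCommutativeMonoid isCommutativeMonoid using (assoc; identityˡ; identityʳ)

  private
    commutativeMonoid : CommutativeMonoid 0ℓ 0ℓ
    commutativeMonoid = record { isCommutativeMonoid = isCommutativeMonoid }

  open CommutativeSemigroupProperties (CommutativeMonoid.commutativeSemigroup commutativeMonoid) using (interchange)

  ∑ : {X : Set} → (X → A) → List X → A
  ∑ f []       = ε
  ∑ f (x ∷ xs) = f x ⊕ ∑ f xs

  when : {P : Set} → Dec P → A → A
  when (yes _) a = a
  when (no _)  _ = ε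

  when-yes : ∀ {P : Set} (P? : Dec P) {a} → P → when P? a ≡ a
  when-yes (yes _) _ = refl
  when-yes (no ¬p) p = contradiction p ¬p

  when-no : ∀ {P : Set} (P? : Dec P) {a} → ¬ P → when P? a ≡ ε
  when-no (yes p) ¬p = contradiction p ¬p
  when-no (no _)  _  = refl

  when-⇔ : ∀ {P Q : Set} (P? : Dec P) (Q? : Dec Q) {a} → (P → Q) → (Q → P) → when P? a ≡ when Q? a
  when-⇔ (yes p) Q? p⇒q _ = sym (when-yes Q? (p⇒q p))
  when-⇔ (no ¬p) Q? _ q⇒p = sym (when-no Q? (¬p ∘ q⇒p))

  ∑-++ : ∀ {X : Set} (f : X → A) xs ys → ∑ f (xs ++ ys) ≡ ∑ f xs ⊕ ∑ f ys
  ∑-++ f []       ys = sym (identityˡ _)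
  ∑-++ f (x ∷ xs) ys = trans (cong (f x ⊕_) (∑-++ f xs ys)) (sym (assoc _ _ _))

  ∑-map : ∀ {X Y : Set} (f : Y → A) (g : X → Y) xs → ∑ f (map g xs) ≡ ∑ (f ∘ g) xs
  ∑-map f g []       = refl
  ∑-map f g (x ∷ xs) = cong (f (g x) ⊕_) (∑-map f g xs)

  ∑-cong : ∀ {X : Set} {f g : X → A} xs → (∀ {x} → x ∈ xs → f x ≡ g x) → ∑ f xs ≡ ∑ g xs
  ∑-cong []       _   = refl
  ∑-cong (x ∷ xs) f≗g = cong₂ _⊕_ (f≗g (here refl)) (∑-cong xs (f≗g ∘ there))

  ∑-ε : ∀ {X : Set} {f : X → A} xs → (∀ {x} → x ∈ xs → f x ≡ ε) → ∑ f xs ≡ ε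
  ∑-ε xs f≗ε = trans (∑-cong xs f≗ε) (∑-const-ε xs)
    where
    ∑-const-ε : ∀ {X : Set} (xs : List X) → ∑ (λ _ → ε) xs ≡ ε
    ∑-const-ε []       = refl
    ∑-const-ε (_ ∷ xs) = trans (cong (ε ⊕_) (∑-const-ε xs)) (identityˡ ε)

  ∑-filter : ∀ {X : Set} {P : X → Set} (P? : Decidable P) (f : X → A) xs →
             ∑ f (filter P? xs) ≡ ∑ (λ x → when (P? x) (f x)) xs
  ∑-filter P? f [] = refl
  ∑-filter P? f (x ∷ xs) with P? x
  ... | yes _ = cong (f x ⊕_) (∑-filter P? f xs)
  ... | no _  = trans (∑-filter P? f xs) (sym (identityˡ _))

  ∑-⊕ : ∀ {X : Set} (f g : X → A) xs → ∑ (λ x → f x ⊕ g x) xs ≡ ∑ f xs ⊕ ∑ g xs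
  ∑-⊕ f g []       = sym (identityˡ ε)
  ∑-⊕ f g (x ∷ xs) = trans (cong ((f x ⊕ g x) ⊕_) (∑-⊕ f g xs)) (interchange _ _ _ _)

  ∑-swap : ∀ {X Y : Set} (F : X → Y → A) xs ys →
           ∑ (λ x → ∑ (F x) ys) xs ≡ ∑ (λ y → ∑ (λ x → F x y) xs) ys
  ∑-swap F []       ys = sym (∑-ε ys (λ _ → refl))
  ∑-swap F (x ∷ xs) ys = trans (cong (∑ (F x) ys ⊕_) (∑-swap F xs ys))
                               (sym (∑-⊕ (F x) (λ y → ∑ (λ x′ → F x′ y) xs) ys))

  ∑-when-≡-unique : ∀ {X : Set} (_≟_ : DecidableEquality X) {a : A} {g : X} xs → Unique xs → g ∈ xs →
                    ∑ (λ x → when (x ≟ g) a) xs ≡ a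
  ∑-when-≡-unique _≟_ {a} {g} (x ∷ xs) (x∉xs ∷ _) (here refl) = begin
    when (g ≟ g) a ⊕ ∑ (λ y → when (y ≟ g) a) xs
      ≡⟨ cong₂ _⊕_ (when-yes (g ≟ g) refl) (∑-ε xs (λ y∈ → when-no (_ ≟ g) (All.lookup x∉xs y∈ ∘ sym))) ⟩
    a ⊕ ε ≡⟨ identityʳ a ⟩
    a     ∎
    where open ≡-Reasoning
  ∑-when-≡-unique _≟_ {a} {g} (x ∷ xs) (x∉xs ∷ xs-unique) (there g∈xs) = begin
    when (x ≟ g) a ⊕ ∑ (λ y → when (y ≟ g) a) xs
      ≡⟨ cong₂ _⊕_ (when-no (x ≟ g) (All.lookup x∉xs g∈xs)) (∑-when-≡-unique _≟_ xs xs-unique g∈xs) ⟩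
    ε ⊕ a ≡⟨ identityˡ a ⟩
    a     ∎
    where open ≡-Reasoning

  ∑-block-multiple : ∀ d′ (h : ℕ → A) N → let d = suc d′ in
    ∑ (λ i → when (d ∣? (N ℕ.* d ℕ.+ i)) (h (N ℕ.* d ℕ.+ i))) (range1 d) ≡ h (suc N ℕ.* d)
  ∑-block-multiple d′ h N = begin
    ∑ (h∣ ∘ (N ℕ.* d ℕ.+_)) (range1 d′ ++ (d ∷ []))
      ≡⟨ ∑-++ (h∣ ∘ (N ℕ.* d ℕ.+_)) (range1 d′) (d ∷ []) ⟩
    ∑ (h∣ ∘ (N ℕ.* d ℕ.+_)) (range1 d′) ⊕ (h∣ (N ℕ.* d ℕ.+ d) ⊕ ε)
      ≡⟨ cong₂ _⊕_ (∑-ε (range1 d′) not-multiple) (identityʳ _) ⟩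
    ε ⊕ h∣ (N ℕ.* d ℕ.+ d)
      ≡⟨ trans (identityˡ _) (when-yes (d ∣? (N ℕ.* d ℕ.+ d)) (subst (d ∣_) (ℕP.+-comm d (N ℕ.* d)) (n∣m*n (suc N)))) ⟩
    h (N ℕ.* d ℕ.+ d) ≡⟨ cong h (ℕP.+-comm (N ℕ.* d) d) ⟩
    h (suc N ℕ.* d)   ∎
    where
    open ≡-Reasoning
    d = suc d′
    h∣ : ℕ → A
    h∣ m = when (d ∣? m) (h m)
    not-multiple : ∀ {i} → i ∈ range1 d′ → h∣ (N ℕ.* d ℕ.+ i) ≡ ε
    not-multiple {i} i∈ = when-no (d ∣? (N ℕ.* d ℕ.+ i)) λ d∣ →
      ℕP.<⇒≱ (s≤s (proj₂ (∈-range1⁻ d′ i∈)))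
        (∣⇒≤ {{ℕ.>-nonZero (proj₁ (∈-range1⁻ d′ i∈))}} (∣m+n∣m⇒∣n d∣ (n∣m*n N)))

  ∑-multiples : ∀ d .{{_ : ℕ.NonZero d}} (h : ℕ → A) N →
                ∑ (λ m → when (d ∣? m) (h m)) (range1 (N ℕ.* d)) ≡ ∑ (λ j → h (j ℕ.* d)) (range1 N)
  ∑-multiples d       h zero    = refl
  ∑-multiples (suc d′) h (suc N) = begin
    ∑ h∣ (range1 (suc N ℕ.* d))
      ≡⟨ cong (∑ h∣ ∘ range1) (ℕP.+-comm d (N ℕ.* d)) ⟩
    ∑ h∣ (range1 (N ℕ.* d ℕ.+ d))
      ≡⟨ cong (∑ h∣) (range1-+ (N ℕ.* d) d) ⟩
    ∑ h∣ (range1 (N ℕ.* d) ++ map (N ℕ.* d ℕ.+_) (range1 d))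
      ≡⟨ ∑-++ h∣ (range1 (N ℕ.* d)) _ ⟩
    ∑ h∣ (range1 (N ℕ.* d)) ⊕ ∑ h∣ (map (N ℕ.* d ℕ.+_) (range1 d))
      ≡⟨ cong₂ _⊕_ (∑-multiples d h N) (trans (∑-map h∣ _ (range1 d)) (∑-block-multiple d′ h N)) ⟩
    ∑ h∘·d (range1 N) ⊕ h (suc N ℕ.* d)
      ≡⟨ cong (∑ h∘·d (range1 N) ⊕_) (sym (identityʳ _)) ⟩
    ∑ h∘·d (range1 N) ⊕ ∑ h∘·d (suc N ∷ [])
      ≡⟨ sym (∑-++ h∘·d (range1 N) (suc N ∷ [])) ⟩
    ∑ h∘·d (range1 (suc N)) ∎
    where
    open ≡-Reasoning
    d = suc d′
    h∣ : ℕ → A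
    h∣ m = when (d ∣? m) (h m)
    h∘·d : ℕ → A
    h∘·d j = h (j ℕ.* d)

module ℕSum = ListSum ℕP.+-0-isCommutativeMonoid
open ℕSum using () renaming (∑ to ∑ℕ; when to whenℕ)

count : ∀ {P : ℕ → Set} → Decidable P → List ℕ → ℕ
count P? = ∑ℕ (λ k → whenℕ (P? k) 1)

length-filter≡count : ∀ {P : ℕ → Set} (P? : Decidable P) xs → length (filter P? xs) ≡ count P? xs
length-filter≡count P? [] = refl
length-filter≡count P? (x ∷ xs) with P? x
... | yes _ = cong suc (length-filter≡count P? xs)
... | no _  = length-filter≡count P? xs

φ≡count : ∀ m → φ m ≡ count (λ k → coprime? k m) (range1 m)
φ≡count m = length-filter≡count (λ k → coprime? k m) (range1 m)

prime≢1 : ∀ {p} → Prime p → p ≢ 1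
prime≢1 pp refl = ¬prime[1] pp

coprime-∣ˡ : ∀ {k a d} → Coprime k a → d ∣ k → Coprime d a
coprime-∣ˡ k⊥a d∣k (i∣d , i∣a) = k⊥a (∣-trans i∣d d∣k , i∣a)

coprime-+ˡ⁻ : ∀ k a → Coprime (a ℕ.+ k) a → Coprime k a
coprime-+ˡ⁻ k a a+k⊥a (i∣k , i∣a) = a+k⊥a (∣m∣n⇒∣m+n i∣a i∣k , i∣a)

¬∣⇒coprime : ∀ {p k} → Prime p → ¬ p ∣ k → Coprime k p
¬∣⇒coprime pp p∤k (i∣k , i∣p) with prime⇒irreducible pp i∣p
... | inj₁ i≡1 = i≡1
... | inj₂ refl = contradiction i∣k p∤k

coprime-*ʳ : ∀ {k p a} → Coprime k p → Coprime k a → Coprime k (p ℕ.* a)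
coprime-*ʳ k⊥p k⊥a (i∣k , i∣pa) = k⊥a (i∣k , coprime-divisor (coprime-∣ˡ k⊥p i∣k) i∣pa)

coprime-*ʳ⁻ : ∀ {k p a} → Prime p → Coprime k (p ℕ.* a) → Coprime k a × ¬ p ∣ k
coprime-*ʳ⁻ {p = p} {a} pp k⊥pa = (λ (i∣k , i∣a) → k⊥pa (i∣k , ∣n⇒∣m*n p i∣a))
                             , (λ p∣k → prime≢1 pp (k⊥pa (p∣k , m∣m*n a)))

coprime-count-periodic : ∀ a .{{_ : ℕ.NonZero a}} q →
                         count (λ k → coprime? k a) (range1 (q ℕ.* a)) ≡ q ℕ.* φ a
coprime-count-periodic a zero    = refl
coprime-count-periodic a (suc q) = begin
  ∑ℕ f (range1 (a ℕ.+ q ℕ.* a))                            ≡⟨ cong (∑ℕ f) (range1-+ a (q ℕ.* a)) ⟩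
  ∑ℕ f (range1 a ++ map (a ℕ.+_) (range1 (q ℕ.* a)))       ≡⟨ ℕSum.∑-++ f (range1 a) _ ⟩
  ∑ℕ f (range1 a) ℕ.+ ∑ℕ f (map (a ℕ.+_) (range1 (q ℕ.* a)))
    ≡⟨ cong₂ ℕ._+_ (sym (φ≡count a)) (ℕSum.∑-map f (a ℕ.+_) (range1 (q ℕ.* a))) ⟩
  φ a ℕ.+ ∑ℕ (f ∘ (a ℕ.+_)) (range1 (q ℕ.* a))
    ≡⟨ cong (φ a ℕ.+_) (ℕSum.∑-cong (range1 (q ℕ.* a)) λ {k} _ →
         ℕSum.when-⇔ (coprime? (a ℕ.+ k) a) (coprime? k a) (coprime-+ˡ⁻ k a) Coprimality.coprime-+) ⟩
  φ a ℕ.+ ∑ℕ f (range1 (q ℕ.* a))                          ≡⟨ cong (φ a ℕ.+_) (coprime-count-periodic a q) ⟩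
  φ a ℕ.+ q ℕ.* φ a                                        ∎
  where
  open ≡-Reasoning
  f : ℕ → ℕ
  f k = whenℕ (coprime? k a) 1

φ-*-prime-∣ : ∀ {p} a .{{_ : ℕ.NonZero a}} → Prime p → p ∣ a → φ (p ℕ.* a) ≡ p ℕ.* φ a
φ-*-prime-∣ {p} a pp p∣a = begin
  φ (p ℕ.* a)                                      ≡⟨ φ≡count (p ℕ.* a) ⟩
  count (λ k → coprime? k (p ℕ.* a)) (range1 (p ℕ.* a))
    ≡⟨ ℕSum.∑-cong (range1 (p ℕ.* a)) (λ {k} _ →
         ℕSum.when-⇔ (coprime? k (p ℕ.* a)) (coprime? k a) (proj₁ ∘ coprime-*ʳ⁻ pp)
           (λ k⊥a → coprime-*ʳ (¬∣⇒coprime pp (λ p∣k → prime≢1 pp (k⊥a (p∣k , p∣a)))) k⊥a)) ⟩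
  count (λ k → coprime? k a) (range1 (p ℕ.* a))    ≡⟨ coprime-count-periodic a p ⟩
  p ℕ.* φ a                                        ∎
  where open ≡-Reasoning

φ-*-prime-∤ : ∀ {p} a .{{_ : ℕ.NonZero a}} → Prime p → ¬ p ∣ a → φ (p ℕ.* a) ≡ (p ℕ.∸ 1) ℕ.* φ a
φ-*-prime-∤ {p} a pp p∤a = begin
  φ (p ℕ.* a)                              ≡⟨ sym (ℕP.m+n∸n≡m (φ (p ℕ.* a)) (φ a)) ⟩
  φ (p ℕ.* a) ℕ.+ φ a ℕ.∸ φ a              ≡⟨ cong (ℕ._∸ φ a) φ[pa]+φ[a]≡p*φ[a] ⟩
  p ℕ.* φ a ℕ.∸ φ a                        ≡⟨ cong (p ℕ.* φ a ℕ.∸_) (sym (ℕP.*-identityˡ (φ a))) ⟩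
  p ℕ.* φ a ℕ.∸ 1 ℕ.* φ a                  ≡⟨ sym (ℕP.*-distribʳ-∸ (φ a) p 1) ⟩
  (p ℕ.∸ 1) ℕ.* φ a                        ∎
  where
  open ≡-Reasoning
  instance _ = prime⇒nonZero pp
  ks = range1 (p ℕ.* a)

  split : ∀ {P Q : Set} (P? : Dec P) (Q? : Dec Q) →
          whenℕ P? 1 ≡ whenℕ (P? ×-dec ¬? Q?) 1 ℕ.+ whenℕ Q? (whenℕ P? 1)
  split (yes _) (yes _) = refl
  split (yes _) (no _)  = refl
  split (no _)  (yes _) = refl
  split (no _)  (no _)  = refl

  coprime-to-pa : count (λ k → coprime? k (p ℕ.* a)) ks ≡ count (λ k → coprime? k a ×-dec ¬? (p ∣? k)) ks
  coprime-to-pa = ℕSum.∑-cong ks λ {k} _ →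
    ℕSum.when-⇔ (coprime? k (p ℕ.* a)) (coprime? k a ×-dec ¬? (p ∣? k))
      (coprime-*ʳ⁻ pp) (λ (k⊥a , p∤k) → coprime-*ʳ (¬∣⇒coprime pp p∤k) k⊥a)

  multiples-of-p : ∑ℕ (λ k → whenℕ (p ∣? k) (whenℕ (coprime? k a) 1)) ks ≡ φ a
  multiples-of-p = begin
    ∑ℕ (λ k → whenℕ (p ∣? k) (whenℕ (coprime? k a) 1)) ks
      ≡⟨ cong (λ x → ∑ℕ (λ k → whenℕ (p ∣? k) (whenℕ (coprime? k a) 1)) (range1 x)) (ℕP.*-comm p a) ⟩
    ∑ℕ (λ k → whenℕ (p ∣? k) (whenℕ (coprime? k a) 1)) (range1 (a ℕ.* p))
      ≡⟨ ℕSum.∑-multiples p (λ k → whenℕ (coprime? k a) 1) a ⟩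
    count (λ j → coprime? (j ℕ.* p) a) (range1 a)
      ≡⟨ ℕSum.∑-cong (range1 a) (λ {j} _ → ℕSum.when-⇔ (coprime? (j ℕ.* p) a) (coprime? j a)
           (λ jp⊥a → coprime-∣ˡ jp⊥a (m∣m*n p))
           (λ j⊥a {i} (i∣jp , i∣a) → j⊥a (coprime-divisor (coprime-∣ˡ (¬∣⇒coprime pp p∤a) i∣a)
                                        (subst (i ∣_) (ℕP.*-comm j p) i∣jp) , i∣a))) ⟩
    count (λ k → coprime? k a) (range1 a)          ≡⟨ sym (φ≡count a) ⟩
    φ a                                            ∎

  φ[pa]+φ[a]≡p*φ[a] : φ (p ℕ.* a) ℕ.+ φ a ≡ p ℕ.* φ a
  φ[pa]+φ[a]≡p*φ[a] = begin
    φ (p ℕ.* a) ℕ.+ φ a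
      ≡⟨ cong₂ ℕ._+_ (trans (φ≡count (p ℕ.* a)) coprime-to-pa) (sym multiples-of-p) ⟩
    count (λ k → coprime? k a ×-dec ¬? (p ∣? k)) ks ℕ.+ ∑ℕ (λ k → whenℕ (p ∣? k) (whenℕ (coprime? k a) 1)) ks
      ≡⟨ sym (ℕSum.∑-⊕ _ _ ks) ⟩
    ∑ℕ (λ k → whenℕ (coprime? k a ×-dec ¬? (p ∣? k)) 1 ℕ.+ whenℕ (p ∣? k) (whenℕ (coprime? k a) 1)) ks
      ≡⟨ ℕSum.∑-cong ks (λ {k} _ → sym (split (coprime? k a) (p ∣? k))) ⟩
    count (λ k → coprime? k a) ks                  ≡⟨ coprime-count-periodic a p ⟩
    p ℕ.* φ a                                      ∎

fromℕ : ℕ → ℚ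
fromℕ a = + a / 1

1/ₙ_ : (b : ℕ) → .{{_ : ℕ.NonZero b}} → ℚ
1/ₙ b = + 1 / b

toℚᵘ-/ : ∀ a b → toℚᵘ (+ a / suc b) ℚᵘ.≃ mkℚᵘ (+ a) b
toℚᵘ-/ a b = ℚP.toℚᵘ-fromℚᵘ (mkℚᵘ (+ a) b)

private
  ≡-via-ℚᵘ : ∀ {p q} {u v : ℚᵘ} → toℚᵘ p ℚᵘ.≃ u → toℚᵘ q ℚᵘ.≃ v → u ℚᵘ.≃ v → p ≡ q
  ≡-via-ℚᵘ p≃u q≃v u≃v = ℚP.toℚᵘ-injective (ℚᵘP.≃-trans p≃u (ℚᵘP.≃-trans u≃v (ℚᵘP.≃-sym q≃v)))

  ≤-via-ℚᵘ : ∀ {p q} {u v : ℚᵘ} → toℚᵘ p ℚᵘ.≃ u → toℚᵘ q ℚᵘ.≃ v → u ℚᵘ.≤ v → p ≤ q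
  ≤-via-ℚᵘ p≃u q≃v u≤v =
    ℚP.toℚᵘ-cancel-≤ (ℚᵘP.≤-respˡ-≃ (ℚᵘP.≃-sym p≃u) (ℚᵘP.≤-respʳ-≃ (ℚᵘP.≃-sym q≃v) u≤v))

  <-via-ℚᵘ : ∀ {p q} {u v : ℚᵘ} → toℚᵘ p ℚᵘ.≃ u → toℚᵘ q ℚᵘ.≃ v → u ℚᵘ.< v → p < q
  <-via-ℚᵘ p≃u q≃v u<v =
    ℚP.toℚᵘ-cancel-< (ℚᵘP.<-respˡ-≃ (ℚᵘP.≃-sym p≃u) (ℚᵘP.<-respʳ-≃ (ℚᵘP.≃-sym q≃v) u<v))

  toℚᵘ-* : ∀ {p q} {u v : ℚᵘ} → toℚᵘ p ℚᵘ.≃ u → toℚᵘ q ℚᵘ.≃ v → toℚᵘ (p * q) ℚᵘ.≃ u ℚᵘ.* v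
  toℚᵘ-* {p} {q} p≃u q≃v = ℚᵘP.≃-trans (ℚP.toℚᵘ-homo-* p q) (ℚᵘP.*-cong p≃u q≃v)

fromℕ-suc : ∀ a → fromℕ (suc a) ≡ fromℕ a + 1ℚ
fromℕ-suc a = trans (≡-via-ℚᵘ (toℚᵘ-/ (suc a) 0)
  (ℚᵘP.≃-trans (ℚP.toℚᵘ-homo-+ 1ℚ (fromℕ a)) (ℚᵘP.+-congʳ (mkℚᵘ (+ 1) 0) (toℚᵘ-/ a 0)))
  (*≡* (cong (ℤ._* + 1) (sym (cong₂ ℤ._+_ (ℤP.*-identityʳ (+ 1)) (ℤP.*-identityʳ (+ a)))))))
  (ℚP.+-comm 1ℚ (fromℕ a))

fromℕ-* : ∀ a b → fromℕ (a ℕ.* b) ≡ fromℕ a * fromℕ b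
fromℕ-* a b = ≡-via-ℚᵘ (toℚᵘ-/ (a ℕ.* b) 0) (toℚᵘ-* (toℚᵘ-/ a 0) (toℚᵘ-/ b 0))
  (*≡* (cong (ℤ._* + 1) (ℤP.pos-* a b)))

/-≡-*-1/ₙ : ∀ a b .{{_ : ℕ.NonZero b}} → + a / b ≡ fromℕ a * 1/ₙ b
/-≡-*-1/ₙ a (suc b) = ≡-via-ℚᵘ (toℚᵘ-/ a b) (toℚᵘ-* (toℚᵘ-/ a 0) (toℚᵘ-/ 1 b))
  (*≡* (sym (ℤP.*-assoc (+ a) (+ 1) (+ suc b))))

1/ₙ-* : ∀ b c .{{_ : ℕ.NonZero b}} .{{_ : ℕ.NonZero c}} → 1/ₙ_ (b ℕ.* c) {{ℕP.m*n≢0 b c}} ≡ 1/ₙ b * 1/ₙ c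
1/ₙ-* (suc b) (suc c) = ≡-via-ℚᵘ (toℚᵘ-/ 1 (c ℕ.+ b ℕ.* suc c)) (toℚᵘ-* (toℚᵘ-/ 1 b) (toℚᵘ-/ 1 c))
  (*≡* (cong (+ 1 ℤ.*_) (ℤP.pos-* (suc b) (suc c))))

fromℕ-*-1/ₙ : ∀ b .{{_ : ℕ.NonZero b}} → fromℕ b * 1/ₙ b ≡ 1ℚ
fromℕ-*-1/ₙ b@(suc _) = trans (sym (/-≡-*-1/ₙ b b)) (≡-via-ℚᵘ (toℚᵘ-/ b _) ℚᵘP.≃-refl
  (*≡* (trans (ℤP.*-identityʳ (+ b)) (sym (ℤP.*-identityˡ (+ b))))))

0≤fromℕ : ∀ a → 0ℚ ≤ fromℕ a
0≤fromℕ a = ≤-via-ℚᵘ ℚᵘP.≃-refl (toℚᵘ-/ a 0) (*≤* (subst (+ 0 ℤ.≤_) (sym (ℤP.*-identityʳ (+ a))) (ℤ.+≤+ z≤n)))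

0<1/ₙ : ∀ b .{{_ : ℕ.NonZero b}} → 0ℚ < 1/ₙ b
0<1/ₙ (suc b) = <-via-ℚᵘ ℚᵘP.≃-refl (toℚᵘ-/ 1 b) (*<* (ℤ.+<+ (s≤s z≤n)))

0≤1/ₙ : ∀ b .{{_ : ℕ.NonZero b}} → 0ℚ ≤ 1/ₙ b
0≤1/ₙ b = ℚP.<⇒≤ (0<1/ₙ b)

1/ₙ-antimono : ∀ {b c} .{{_ : ℕ.NonZero b}} .{{_ : ℕ.NonZero c}} → b ℕ.≤ c → 1/ₙ c ≤ 1/ₙ b
1/ₙ-antimono {suc b} {suc c} b≤c = ≤-via-ℚᵘ (toℚᵘ-/ 1 c) (toℚᵘ-/ 1 b)
  (*≤* (subst₂ ℤ._≤_ (sym (ℤP.*-identityˡ _)) (sym (ℤP.*-identityˡ _)) (ℤ.+≤+ b≤c)))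

≤-fromℕ : ∀ x → ∃ λ B → x ≤ fromℕ B
≤-fromℕ (mkℚ (+ a) d _) = a , ≤-via-ℚᵘ ℚᵘP.≃-refl (toℚᵘ-/ a 0)
  (*≤* (subst₂ ℤ._≤_ (sym (ℤP.*-identityʳ (+ a))) (ℤP.pos-* a (suc d)) (ℤ.+≤+ (ℕP.m≤m*n a (suc d)))))
≤-fromℕ (mkℚ ℤ.-[1+ _ ] _ _) = 0 , ℚ.*≤* ℤ.-≤+

archimedean : ∀ B {δ} → 0ℚ < δ → ∃ λ K → fromℕ B * 1/ₙ (suc K) < δ
archimedean B {mkℚ (+ zero) _ _} (ℚ.*<* (ℤ.+<+ ()))
archimedean B {mkℚ ℤ.-[1+ _ ] _ _} (ℚ.*<* ())
archimedean B {mkℚ (+ suc a) d _} _ = B ℕ.* suc d , (begin-strict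
    fromℕ B * 1/ₙ (suc (B ℕ.* suc d)) ≡⟨ sym (/-≡-*-1/ₙ B _) ⟩
    + B / suc (B ℕ.* suc d)           <⟨ <-via-ℚᵘ (toℚᵘ-/ B _) (toℚᵘ-/ 1 d) (*<* B/[1+Bd]<1/d) ⟩
    1/ₙ (suc d)                       ≤⟨ ≤-via-ℚᵘ (toℚᵘ-/ 1 d) ℚᵘP.≃-refl (*≤* 1/d≤a/d) ⟩
    mkℚ (+ suc a) d _                 ∎)
  where
  open ℚP.≤-Reasoning
  B/[1+Bd]<1/d : + B ℤ.* + suc d ℤ.< + 1 ℤ.* + suc (B ℕ.* suc d)
  B/[1+Bd]<1/d = subst₂ ℤ._<_ (ℤP.pos-* B (suc d)) (sym (ℤP.*-identityˡ _)) (ℤ.+<+ ℕP.≤-refl)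
  1/d≤a/d : + 1 ℤ.* + suc d ℤ.≤ + suc a ℤ.* + suc d
  1/d≤a/d = subst₂ ℤ._≤_ (sym (ℤP.*-identityˡ _)) (ℤP.pos-* (suc a) (suc d)) (ℤ.+≤+ (ℕP.m≤n*m (suc d) (suc a)))

*-monoˡ-≤-0≤ : ∀ {c a b} → 0ℚ ≤ c → a ≤ b → c * a ≤ c * b
*-monoˡ-≤-0≤ {c} 0≤c = ℚP.*-monoˡ-≤-nonNeg c {{ℚ.nonNegative 0≤c}}

*-monoʳ-≤-0≤ : ∀ {c a b} → 0ℚ ≤ c → a ≤ b → a * c ≤ b * c
*-monoʳ-≤-0≤ {c} 0≤c = ℚP.*-monoʳ-≤-nonNeg c {{ℚ.nonNegative 0≤c}}

0≤* : ∀ {a b} → 0ℚ ≤ a → 0ℚ ≤ b → 0ℚ ≤ a * b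
0≤* {a} {b} 0≤a 0≤b = subst (_≤ a * b) (ℚP.*-zeroʳ a) (*-monoˡ-≤-0≤ 0≤a 0≤b)

≤-+ʳ : ∀ {a b} → 0ℚ ≤ b → a ≤ a + b
≤-+ʳ {a} {b} 0≤b = subst (_≤ a + b) (ℚP.+-identityʳ a) (ℚP.+-monoʳ-≤ a 0≤b)

module ℚSum = ListSum ℚP.+-0-isCommutativeMonoid
open ℚSum using (∑; when)

sumℚ-map : ∀ {X : Set} (f : X → ℚ) xs → sumℚ (map f xs) ≡ ∑ f xs
sumℚ-map f []       = refl
sumℚ-map f (x ∷ xs) = cong (_+_ (f x)) (sumℚ-map f xs)

0≤when : ∀ {P : Set} (P? : Dec P) {a} → 0ℚ ≤ a → 0ℚ ≤ when P? a
0≤when (yes _) 0≤a = 0≤a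
0≤when (no _)  _   = ℚP.≤-refl

when-*ˡ : ∀ {P : Set} (P? : Dec P) c a → when P? (c * a) ≡ c * when P? a
when-*ˡ (yes _) c a = refl
when-*ˡ (no _)  c a = sym (ℚP.*-zeroʳ c)

∑-mono : ∀ {X : Set} {f g : X → ℚ} xs → (∀ {x} → x ∈ xs → f x ≤ g x) → ∑ f xs ≤ ∑ g xs
∑-mono []       _   = ℚP.≤-refl
∑-mono (x ∷ xs) f≤g = ℚP.+-mono-≤ (f≤g (here refl)) (∑-mono xs (f≤g ∘ there))

0≤∑ : ∀ {X : Set} {f : X → ℚ} xs → (∀ {x} → x ∈ xs → 0ℚ ≤ f x) → 0ℚ ≤ ∑ f xs
0≤∑ xs 0≤f = subst (_≤ ∑ _ xs) (ℚSum.∑-ε xs (λ _ → refl)) (∑-mono xs 0≤f)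

∑-*ˡ : ∀ {X : Set} c (f : X → ℚ) xs → c * ∑ f xs ≡ ∑ (λ x → c * f x) xs
∑-*ˡ c f []       = ℚP.*-zeroʳ c
∑-*ˡ c f (x ∷ xs) = trans (ℚP.*-distribˡ-+ c (f x) (∑ f xs)) (cong (_+_ (c * f x)) (∑-*ˡ c f xs))

∑-range1-mono : ∀ (f : ℕ → ℚ) → (∀ m → 0ℚ ≤ f m) → ∀ {N N′} → N ℕ.≤ N′ → ∑ f (range1 N) ≤ ∑ f (range1 N′)
∑-range1-mono f 0≤f {N} {N′} N≤N′ = begin
  ∑ f (range1 N)                                       ≤⟨ ≤-+ʳ (0≤∑ (map (N ℕ.+_) (range1 (N′ ℕ.∸ N))) (λ _ → 0≤f _)) ⟩
  ∑ f (range1 N) + ∑ f (map (N ℕ.+_) (range1 (N′ ℕ.∸ N))) ≡⟨ sym (ℚSum.∑-++ f (range1 N) _) ⟩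
  ∑ f (range1 N ++ map (N ℕ.+_) (range1 (N′ ℕ.∸ N)))    ≡⟨ cong (∑ f) (sym (range1-+ N (N′ ℕ.∸ N))) ⟩
  ∑ f (range1 (N ℕ.+ (N′ ℕ.∸ N)))                      ≡⟨ cong (∑ f ∘ range1) (ℕP.m+[n∸m]≡n N≤N′) ⟩
  ∑ f (range1 N′)                                      ∎
  where open ℚP.≤-Reasoning

term≡ : ∀ m .{{_ : ℕ.NonZero m}} → term m ≡ fromℕ (φ m) * (1/ₙ m * 1/ₙ m)
term≡ m@(suc _) = trans (/-≡-*-1/ₙ (φ m) (m ℕ.* m)) (cong (fromℕ (φ m) *_) (1/ₙ-* m m))

term-*-φ : ∀ j p k .{{_ : ℕ.NonZero j}} .{{_ : ℕ.NonZero p}} → φ (j ℕ.* p) ≡ k ℕ.* φ j →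
           term (j ℕ.* p) ≡ (fromℕ k * (1/ₙ p * 1/ₙ p)) * term j
term-*-φ j p k φ[jp]≡kφ[j] = begin
  term (j ℕ.* p)                                        ≡⟨ term≡ (j ℕ.* p) ⟩
  fromℕ (φ (j ℕ.* p)) * (1/ₙ (j ℕ.* p) * 1/ₙ (j ℕ.* p))
    ≡⟨ cong₂ (λ x y → fromℕ x * (y * y)) φ[jp]≡kφ[j] (1/ₙ-* j p) ⟩
  fromℕ (k ℕ.* φ j) * ((1/ₙ j * 1/ₙ p) * (1/ₙ j * 1/ₙ p)) ≡⟨ cong (_* ((1/ₙ j * 1/ₙ p) * (1/ₙ j * 1/ₙ p))) (fromℕ-* k (φ j)) ⟩
  (fromℕ k * fromℕ (φ j)) * ((1/ₙ j * 1/ₙ p) * (1/ₙ j * 1/ₙ p))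
    ≡⟨ regroup (fromℕ k) (fromℕ (φ j)) (1/ₙ j) (1/ₙ p) ⟩
  (fromℕ k * (1/ₙ p * 1/ₙ p)) * (fromℕ (φ j) * (1/ₙ j * 1/ₙ j)) ≡⟨ cong ((fromℕ k * (1/ₙ p * 1/ₙ p)) *_) (sym (term≡ j)) ⟩
  (fromℕ k * (1/ₙ p * 1/ₙ p)) * term j                  ∎
  where
  open ≡-Reasoning
  open +-*-Solver
  instance _ = ℕP.m*n≢0 j p
  regroup : ∀ c x u v → (c * x) * ((u * v) * (u * v)) ≡ (c * (v * v)) * (x * (u * u))
  regroup = solve 4 (λ c x u v → (c :* x) :* ((u :* v) :* (u :* v)) := (c :* (v :* v)) :* (x :* (u :* u))) refl

term-*-prime-∣ : ∀ {p} j .{{_ : ℕ.NonZero j}} .{{_ : ℕ.NonZero p}} → Prime p → p ∣ j →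
                 term (j ℕ.* p) ≡ 1/ₙ p * term j
term-*-prime-∣ {p} j pp p∣j = begin
  term (j ℕ.* p)                         ≡⟨ term-*-φ j p p (trans (cong φ (ℕP.*-comm j p)) (φ-*-prime-∣ j pp p∣j)) ⟩
  (fromℕ p * (1/ₙ p * 1/ₙ p)) * term j   ≡⟨ cong (_* term j) (sym (ℚP.*-assoc (fromℕ p) _ _)) ⟩
  ((fromℕ p * 1/ₙ p) * 1/ₙ p) * term j   ≡⟨ cong (λ x → (x * 1/ₙ p) * term j) (fromℕ-*-1/ₙ p) ⟩
  (1ℚ * 1/ₙ p) * term j                  ≡⟨ cong (_* term j) (ℚP.*-identityˡ (1/ₙ p)) ⟩
  1/ₙ p * term j                         ∎
  where open ≡-Reasoning

φ-prime : ∀ {p} → Prime p → φ p ≡ p ℕ.∸ 1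
φ-prime {p} pp = begin
  φ p                     ≡⟨ cong φ (sym (ℕP.*-identityʳ p)) ⟩
  φ (p ℕ.* 1)             ≡⟨ φ-*-prime-∤ 1 pp (λ p∣1 → prime≢1 pp (∣1⇒≡1 p∣1)) ⟩
  (p ℕ.∸ 1) ℕ.* 1         ≡⟨ ℕP.*-identityʳ (p ℕ.∸ 1) ⟩
  p ℕ.∸ 1                 ∎
  where open ≡-Reasoning

term-prime : ∀ {p} .{{_ : ℕ.NonZero p}} → Prime p → term p ≡ fromℕ (p ℕ.∸ 1) * (1/ₙ p * 1/ₙ p)
term-prime {p} pp = trans (term≡ p) (cong (λ x → fromℕ x * (1/ₙ p * 1/ₙ p)) (φ-prime pp))

term-*-prime-∤ : ∀ {p} j .{{_ : ℕ.NonZero j}} .{{_ : ℕ.NonZero p}} → Prime p → ¬ p ∣ j →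
                 term (j ℕ.* p) ≡ term p * term j
term-*-prime-∤ {p} j pp p∤j = begin
  term (j ℕ.* p)                               ≡⟨ term-*-φ j p (p ℕ.∸ 1) (trans (cong φ (ℕP.*-comm j p)) (φ-*-prime-∤ j pp p∤j)) ⟩
  (fromℕ (p ℕ.∸ 1) * (1/ₙ p * 1/ₙ p)) * term j ≡⟨ cong (_* term j) (sym (term-prime pp)) ⟩
  term p * term j                              ∎
  where open ≡-Reasoning

term-prime+1/p² : ∀ {p} .{{_ : ℕ.NonZero p}} → Prime p → term p + 1/ₙ p * 1/ₙ p ≡ 1/ₙ p
term-prime+1/p² {p@(suc p′)} pp = begin
  term p + 1/ₙ p * 1/ₙ p                              ≡⟨ cong₂ _+_ (term-prime pp) (sym (ℚP.*-identityˡ _)) ⟩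
  fromℕ p′ * (1/ₙ p * 1/ₙ p) + 1ℚ * (1/ₙ p * 1/ₙ p)   ≡⟨ sym (ℚP.*-distribʳ-+ _ (fromℕ p′) 1ℚ) ⟩
  (fromℕ p′ + 1ℚ) * (1/ₙ p * 1/ₙ p)                   ≡⟨ cong (_* (1/ₙ p * 1/ₙ p)) (sym (fromℕ-suc p′)) ⟩
  fromℕ p * (1/ₙ p * 1/ₙ p)                           ≡⟨ sym (ℚP.*-assoc (fromℕ p) _ _) ⟩
  (fromℕ p * 1/ₙ p) * 1/ₙ p                           ≡⟨ cong (_* 1/ₙ p) (fromℕ-*-1/ₙ p) ⟩
  1ℚ * 1/ₙ p                                          ≡⟨ ℚP.*-identityˡ (1/ₙ p) ⟩
  1/ₙ p                                               ∎
  where open ≡-Reasoning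

0≤term : ∀ m → 0ℚ ≤ term m
0≤term zero      = ℚP.≤-refl
0≤term m@(suc _) = subst (0ℚ ≤_) (sym (term≡ m)) (0≤* (0≤fromℕ (φ m)) (0≤* (0≤1/ₙ m) (0≤1/ₙ m)))

∈-primeDivisors⁻ : ∀ {q m} → q ∈ primeDivisors m → Prime q × q ∣ m
∈-primeDivisors⁻ {m = m} q∈ = proj₂ (∈-filter⁻ (λ p → prime? p ×-dec (p ∣? m)) {xs = range1 m} q∈)

∈-primeDivisors⁺ : ∀ {q m} → 1 ℕ.≤ m → Prime q → q ∣ m → q ∈ primeDivisors m
∈-primeDivisors⁺ {q} {m} 1≤m pq q∣m = ∈-filter⁺ (λ p → prime? p ×-dec (p ∣? m))
  (∈-range1⁺ m (ℕ.>-nonZero⁻¹ q {{prime⇒nonZero pq}}) (∣⇒≤ {{ℕ.>-nonZero 1≤m}} q∣m)) (pq , q∣m)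

prime-factor : ∀ m → 1 ℕ.≤ m → m ≢ 1 → ∃ λ q → Prime q × q ∣ m
prime-factor m@(suc _) _ m≢1 with factorise m
... | record { factors = [] ; isFactorisation = m≡1 } = contradiction m≡1 m≢1
... | record { factors = q ∷ qs ; isFactorisation = m≡∏ ; factorsPrime = pq ∷ _ } =
  q , pq , subst (q ∣_) (sym m≡∏) (m∣m*n (product qs))

SupportedIn : List ℕ → ℕ → Set
SupportedIn ps m = All (_∈ ps) (primeDivisors m)

supportedIn? : ∀ ps → Decidable (SupportedIn ps)
supportedIn? ps m = All.all? (_∈? ps) (primeDivisors m)

supportedIn⁻ : ∀ {ps m q} → 1 ℕ.≤ m → SupportedIn ps m → Prime q → q ∣ m → q ∈ ps
supportedIn⁻ 1≤m m∈ps pq q∣m = All.lookup m∈ps (∈-primeDivisors⁺ 1≤m pq q∣m)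

supportedIn⁺ : ∀ {ps m} → (∀ {q} → Prime q → q ∣ m → q ∈ ps) → SupportedIn ps m
supportedIn⁺ factors∈ps = All.tabulate (λ q∈ → let (pq , q∣m) = ∈-primeDivisors⁻ q∈ in factors∈ps pq q∣m)

supportedIn-[]⇒≡1 : ∀ {m} → 1 ℕ.≤ m → SupportedIn [] m → m ≡ 1
supportedIn-[]⇒≡1 {m} 1≤m m∈[] with m ℕ.≟ 1
... | yes m≡1 = m≡1
... | no m≢1 with prime-factor m 1≤m m≢1
... | q , pq , q∣m with supportedIn⁻ 1≤m m∈[] pq q∣m
... | ()

supportedIn-1 : ∀ ps → SupportedIn ps 1
supportedIn-1 ps = supportedIn⁺ λ pq q∣1 → contradiction (∣1⇒≡1 q∣1) (prime≢1 pq)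

module _ {p} (pp : Prime p) {qs} (p∉qs : p ∉ qs) where

  supportedIn⇒∤ : ∀ {m} → 1 ℕ.≤ m → SupportedIn qs m → ¬ p ∣ m
  supportedIn⇒∤ 1≤m m∈qs p∣m = p∉qs (supportedIn⁻ 1≤m m∈qs pp p∣m)

  supportedIn-∷⁻ : ∀ {m} → 1 ℕ.≤ m → ¬ p ∣ m → SupportedIn (p ∷ qs) m → SupportedIn qs m
  supportedIn-∷⁻ {m} 1≤m p∤m m∈pqs = supportedIn⁺ λ pq q∣m → drop-p q∣m (supportedIn⁻ 1≤m m∈pqs pq q∣m)
    where
    drop-p : ∀ {q} → q ∣ m → q ∈ p ∷ qs → q ∈ qs
    drop-p q∣m (here refl) = contradiction q∣m p∤m
    drop-p q∣m (there q∈qs) = q∈qs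

  supportedIn-*p⁻ : ∀ {j} → 1 ℕ.≤ j → SupportedIn (p ∷ qs) (j ℕ.* p) → SupportedIn (p ∷ qs) j
  supportedIn-*p⁻ {j} 1≤j jp∈pqs = supportedIn⁺ {m = j} λ pq q∣j → supportedIn⁻ 1≤jp jp∈pqs pq (∣-trans q∣j (m∣m*n p))
    where
    1≤jp : 1 ℕ.≤ j ℕ.* p
    1≤jp = ℕP.*-mono-≤ 1≤j (ℕ.>-nonZero⁻¹ p {{prime⇒nonZero pp}})

  supportedIn-*p⁺ : ∀ {j} → 1 ℕ.≤ j → SupportedIn (p ∷ qs) j → SupportedIn (p ∷ qs) (j ℕ.* p)
  supportedIn-*p⁺ {j} 1≤j j∈pqs = supportedIn⁺ {m = j ℕ.* p} λ pq q∣jp → factor∈ pq (euclidsLemma j p pq q∣jp)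
    where
    factor∈ : ∀ {q} → Prime q → q ∣ j ⊎ q ∣ p → q ∈ p ∷ qs
    factor∈ pq (inj₁ q∣j) = supportedIn⁻ 1≤j j∈pqs pq q∣j
    factor∈ pq (inj₂ q∣p) with prime⇒irreducible pp q∣p
    ... | inj₁ q≡1 = contradiction q≡1 (prime≢1 pq)
    ... | inj₂ refl = here refl

supportedSum : List ℕ → ℕ → ℚ
supportedSum ps N = ∑ (λ m → when (supportedIn? ps m) (term m)) (range1 N)

supportedSum-mono : ∀ ps {N N′} → N ℕ.≤ N′ → supportedSum ps N ≤ supportedSum ps N′
supportedSum-mono ps = ∑-range1-mono _ (λ m → 0≤when (supportedIn? ps m) (0≤term m))

supportedSum-[] : ∀ N → supportedSum [] (suc N) ≡ 1ℚ
supportedSum-[] N = begin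
  ∑ f (range1 (1 ℕ.+ N))                         ≡⟨ cong (∑ f) (range1-+ 1 N) ⟩
  ∑ f (range1 1 ++ map suc (range1 N))           ≡⟨ ℚSum.∑-++ f (range1 1) (map suc (range1 N)) ⟩
  f 1 + 0ℚ + ∑ f (map suc (range1 N))
    ≡⟨ cong₂ _+_ (cong (_+ 0ℚ) (ℚSum.when-yes (supportedIn? [] 1) {term 1} (supportedIn-1 [])))
                 (trans (ℚSum.∑-map f suc (range1 N)) (ℚSum.∑-ε (range1 N) unsupported)) ⟩
  1ℚ                                             ∎
  where
  open ≡-Reasoning
  f : ℕ → ℚ
  f m = when (supportedIn? [] m) (term m)
  unsupported : ∀ {k} → k ∈ range1 N → f (suc k) ≡ 0ℚ
  unsupported {k} k∈ = ℚSum.when-no (supportedIn? [] (suc k)) λ 1+k∈[] →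
    ℕP.>⇒≢ (proj₁ (∈-range1⁻ N k∈)) (ℕP.suc-injective (supportedIn-[]⇒≡1 (s≤s z≤n) 1+k∈[]))

module _ {p} (pp : Prime p) {qs} (p∉qs : p ∉ qs) where

  private
    instance _ = prime⇒nonZero pp

  divisibleSum : ℕ → ℚ
  divisibleSum N = ∑ (λ m → when (p ∣? m) (when (supportedIn? (p ∷ qs) m) (term m))) (range1 N)

  divisibleSum-mono : ∀ {M N} → M ℕ.≤ N → divisibleSum M ≤ divisibleSum N
  divisibleSum-mono = ∑-range1-mono _ (λ m → 0≤when (p ∣? m) (0≤when (supportedIn? (p ∷ qs) m) (0≤term m)))

  supportedSum-∷ : ∀ N → supportedSum (p ∷ qs) N ≡ supportedSum qs N + divisibleSum N
  supportedSum-∷ N = trans (ℚSum.∑-cong (range1 N) (λ m∈ → split (proj₁ (∈-range1⁻ N m∈)) (p ∣? _)))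
                           (ℚSum.∑-⊕ _ _ (range1 N))
    where
    split : ∀ {m} → 1 ℕ.≤ m → (p∣?m : Dec (p ∣ m)) →
            when (supportedIn? (p ∷ qs) m) (term m)
              ≡ when (supportedIn? qs m) (term m) + when p∣?m (when (supportedIn? (p ∷ qs) m) (term m))
    split {m} 1≤m (yes p∣m) = sym (trans
      (cong (_+ when (supportedIn? (p ∷ qs) m) (term m))
            (ℚSum.when-no (supportedIn? qs m) {term m} (λ m∈qs → supportedIn⇒∤ pp p∉qs 1≤m m∈qs p∣m)))
      (ℚP.+-identityˡ _))
    split {m} 1≤m (no p∤m) = sym (trans
      (cong (_+ 0ℚ) (ℚSum.when-⇔ (supportedIn? qs m) (supportedIn? (p ∷ qs) m)
                                 (All.map there) (supportedIn-∷⁻ pp p∉qs 1≤m p∤m)))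
      (ℚP.+-identityʳ _))

  divisibleSum-*p : ∀ N → divisibleSum (N ℕ.* p) ≡ 1/ₙ p * divisibleSum N + term p * supportedSum qs N
  divisibleSum-*p N = begin
    divisibleSum (N ℕ.* p)
      ≡⟨ ℚSum.∑-multiples p (λ m → when (supportedIn? (p ∷ qs) m) (term m)) N ⟩
    ∑ (λ j → when (supportedIn? (p ∷ qs) (j ℕ.* p)) (term (j ℕ.* p))) (range1 N)
      ≡⟨ ℚSum.∑-cong (range1 N) (λ j∈ → summand (proj₁ (∈-range1⁻ N j∈)) (p ∣? _)) ⟩
    ∑ (λ j → 1/ₙ p * divisible j + term p * supported j) (range1 N)
      ≡⟨ ℚSum.∑-⊕ _ _ (range1 N) ⟩
    ∑ (λ j → 1/ₙ p * divisible j) (range1 N) + ∑ (λ j → term p * supported j) (range1 N)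
      ≡⟨ sym (cong₂ _+_ (∑-*ˡ (1/ₙ p) divisible (range1 N)) (∑-*ˡ (term p) supported (range1 N))) ⟩
    1/ₙ p * divisibleSum N + term p * supportedSum qs N ∎
    where
    open ≡-Reasoning
    supported : ℕ → ℚ
    supported j = when (supportedIn? qs j) (term j)
    divisible : ℕ → ℚ
    divisible j = when (p ∣? j) (when (supportedIn? (p ∷ qs) j) (term j))

    summand : ∀ {j} → 1 ℕ.≤ j → Dec (p ∣ j) →
              when (supportedIn? (p ∷ qs) (j ℕ.* p)) (term (j ℕ.* p)) ≡ 1/ₙ p * divisible j + term p * supported j
    summand {j@(suc _)} 1≤j (yes p∣j) = begin
      when (supportedIn? (p ∷ qs) (j ℕ.* p)) (term (j ℕ.* p))
        ≡⟨ ℚSum.when-⇔ (supportedIn? (p ∷ qs) (j ℕ.* p)) (supportedIn? (p ∷ qs) j) {term (j ℕ.* p)}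
             (supportedIn-*p⁻ pp p∉qs 1≤j) (supportedIn-*p⁺ pp p∉qs 1≤j) ⟩
      when (supportedIn? (p ∷ qs) j) (term (j ℕ.* p))
        ≡⟨ cong (when (supportedIn? (p ∷ qs) j)) (term-*-prime-∣ j pp p∣j) ⟩
      when (supportedIn? (p ∷ qs) j) (1/ₙ p * term j)
        ≡⟨ when-*ˡ (supportedIn? (p ∷ qs) j) (1/ₙ p) (term j) ⟩
      1/ₙ p * when (supportedIn? (p ∷ qs) j) (term j)
        ≡⟨ sym (ℚP.+-identityʳ _) ⟩
      1/ₙ p * when (supportedIn? (p ∷ qs) j) (term j) + 0ℚ
        ≡⟨ cong₂ _+_ (cong (1/ₙ p *_) (sym (ℚSum.when-yes (p ∣? j) p∣j)))
                     (sym (trans (cong (term p *_) (ℚSum.when-no (supportedIn? qs j) {term j} p∤-qs-supported))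
                                 (ℚP.*-zeroʳ (term p)))) ⟩
      1/ₙ p * divisible j + term p * supported j        ∎
      where
      p∤-qs-supported : ¬ SupportedIn qs j
      p∤-qs-supported j∈qs = supportedIn⇒∤ pp p∉qs 1≤j j∈qs p∣j
    summand {j@(suc _)} 1≤j (no p∤j) = begin
      when (supportedIn? (p ∷ qs) (j ℕ.* p)) (term (j ℕ.* p))
        ≡⟨ ℚSum.when-⇔ (supportedIn? (p ∷ qs) (j ℕ.* p)) (supportedIn? qs j) {term (j ℕ.* p)}
             (supportedIn-∷⁻ pp p∉qs 1≤j p∤j ∘ supportedIn-*p⁻ pp p∉qs 1≤j)
             (supportedIn-*p⁺ pp p∉qs 1≤j ∘ All.map there) ⟩
      when (supportedIn? qs j) (term (j ℕ.* p))
        ≡⟨ cong (when (supportedIn? qs j)) (term-*-prime-∤ j pp p∤j) ⟩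
      when (supportedIn? qs j) (term p * term j)
        ≡⟨ when-*ˡ (supportedIn? qs j) (term p) (term j) ⟩
      term p * supported j                               ≡⟨ sym (ℚP.+-identityˡ _) ⟩
      0ℚ + term p * supported j
        ≡⟨ cong (_+ term p * supported j) (sym (trans (cong (1/ₙ p *_) (ℚSum.when-no (p ∣? j) p∤j)) (ℚP.*-zeroʳ (1/ₙ p)))) ⟩
      1/ₙ p * divisible j + term p * supported j         ∎

IsSupremum : (ℕ → ℚ) → ℚ → Set
IsSupremum s L = (∀ N → s N ≤ L) × (∀ ε → 0ℚ < ε → ∃ λ N → L < s N + ε)

½ : ℚ
½ = 1/ₙ 2

≤-*ˡ-≤½⇒≤0 : ∀ {x ρ} → 0ℚ ≤ ρ → ρ ≤ ½ → x ≤ ρ * x → x ≤ 0ℚ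
≤-*ˡ-≤½⇒≤0 {x} {ρ} 0≤ρ ρ≤½ x≤ρx = ℚP.≮⇒≥ λ 0<x → ℚP.<-irrefl refl (begin-strict
  x              ≤⟨ x≤ρx ⟩
  ρ * x          ≤⟨ *-monoʳ-≤-0≤ (ℚP.<⇒≤ 0<x) ρ≤½ ⟩
  ½ * x          ≡⟨ sym (ℚP.+-identityʳ (½ * x)) ⟩
  ½ * x + 0ℚ     <⟨ ℚP.+-monoʳ-< (½ * x) (subst (_< ½ * x) (ℚP.*-zeroˡ x) (ℚP.*-monoˡ-<-pos x {{ℚ.positive 0<x}} (0<1/ₙ 2))) ⟩
  ½ * x + ½ * x  ≡⟨ trans (sym (ℚP.*-distribʳ-+ x ½ ½)) (ℚP.*-identityˡ x) ⟩
  x              ∎)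
  where open ℚP.≤-Reasoning

½-contraction : ∀ B K δ → 0ℚ ≤ fromℕ B →
                ½ * (δ + fromℕ B * 1/ₙ (suc K)) + ½ * δ ≤ δ + fromℕ B * 1/ₙ (suc (suc K))
½-contraction B K δ 0≤B = begin
  ½ * (δ + fromℕ B * 1/ₙ (suc K)) + ½ * δ      ≡⟨ regroup ½ δ (fromℕ B) (1/ₙ (suc K)) ⟩
  (½ + ½) * δ + fromℕ B * (½ * 1/ₙ (suc K))    ≡⟨ cong₂ (λ x y → x * δ + fromℕ B * y) {½ + ½} {1ℚ} refl (sym (1/ₙ-* 2 (suc K))) ⟩
  1ℚ * δ + fromℕ B * 1/ₙ (2 ℕ.* suc K)         ≡⟨ cong (_+ fromℕ B * 1/ₙ (2 ℕ.* suc K)) (ℚP.*-identityˡ δ) ⟩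
  δ + fromℕ B * 1/ₙ (2 ℕ.* suc K)              ≤⟨ ℚP.+-monoʳ-≤ δ (*-monoˡ-≤-0≤ 0≤B (1/ₙ-antimono 2+K≤2*[1+K])) ⟩
  δ + fromℕ B * 1/ₙ (suc (suc K))              ∎
  where
  open ℚP.≤-Reasoning
  open +-*-Solver
  2+K≤2*[1+K] : 2 ℕ.+ K ℕ.≤ 2 ℕ.* suc K
  2+K≤2*[1+K] = subst (ℕ._≤ 2 ℕ.* suc K) (ℕP.+-comm (suc K) 1) (ℕP.+-monoʳ-≤ (suc K) (s≤s z≤n))
  regroup : ∀ h d b r → h * (d + b * r) + h * d ≡ (h + h) * d + b * (h * r)
  regroup = solve 4 (λ h d b r → h :* (d :+ b :* r) :+ h :* d := (h :+ h) :* d :+ b :* (h :* r)) refl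

module SelfSimilar {A V : ℕ → ℚ} {ρ c P : ℚ} (k : ℕ) .{{_ : ℕ.NonZero k}}
  (A-mono : ∀ {M N} → M ℕ.≤ N → A M ≤ A N)
  (0≤V : ∀ N → 0ℚ ≤ V N)
  (V-mono : ∀ {M N} → M ℕ.≤ N → V M ≤ V N)
  (V-*k : ∀ N → V (N ℕ.* k) ≡ ρ * V N + c * A N)
  (0≤ρ : 0ℚ ≤ ρ) (ρ≤½ : ρ ≤ ½) (0≤c : 0ℚ ≤ c) (c+ρ²≡ρ : c + ρ * ρ ≡ ρ)
  (A-sup : IsSupremum A P)
  where

  open ℚP.≤-Reasoning
  open +-*-Solver

  c≤½ : c ≤ ½
  c≤½ = ℚP.≤-trans (subst (c ≤_) c+ρ²≡ρ (≤-+ʳ (0≤* 0≤ρ 0≤ρ))) ρ≤½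

  V≤ρP : ∀ N → V N ≤ ρ * P
  V≤ρP N = x-y≤0⇒x≤y (≤-*ˡ-≤½⇒≤0 0≤ρ ρ≤½ (begin
    V N - ρ * P                          ≤⟨ ℚP.+-monoˡ-≤ (- (ρ * P)) (begin
        V N                ≤⟨ V-mono (ℕP.m≤m*n N k) ⟩
        V (N ℕ.* k)        ≡⟨ V-*k N ⟩
        ρ * V N + c * A N  ≤⟨ ℚP.+-monoʳ-≤ (ρ * V N) (*-monoˡ-≤-0≤ 0≤c (proj₁ A-sup N)) ⟩
        ρ * V N + c * P    ∎) ⟩
    (ρ * V N + c * P) - ρ * P            ≡⟨ cong (λ x → (ρ * V N + x * P) - ρ * P) (x+y≡z⇒x≡z-y {c} {ρ * ρ} {ρ} c+ρ²≡ρ) ⟩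
    (ρ * V N + (ρ - ρ * ρ) * P) - ρ * P  ≡⟨ contract (V N) ρ P ⟩
    ρ * (V N - ρ * P)                    ∎))
    where
    contract : ∀ v ρ P → (ρ * v + (ρ - ρ * ρ) * P) - ρ * P ≡ ρ * (v - ρ * P)
    contract = solve 3 (λ v ρ P → (ρ :* v :+ (ρ :- ρ :* ρ) :* P) :- ρ :* P := ρ :* (v :- ρ :* P)) refl
    x+y≡z⇒x≡z-y : ∀ {x y z} → x + y ≡ z → x ≡ z - y
    x+y≡z⇒x≡z-y {x} {y} refl = sym (solve 2 (λ x y → (x :+ y) :- y := x) refl x y)
    x-y≤0⇒x≤y : ∀ {x y} → x - y ≤ 0ℚ → x ≤ y
    x-y≤0⇒x≤y {x} {y} x-y≤0 = begin
      x              ≡⟨ solve 2 (λ x y → x := (x :- y) :+ y) refl x y ⟩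
      (x - y) + y    ≤⟨ ℚP.+-monoˡ-≤ y x-y≤0 ⟩
      0ℚ + y         ≡⟨ ℚP.+-identityˡ y ⟩
      y              ∎

  A+V≤[1+ρ]P : ∀ N → A N + V N ≤ (1ℚ + ρ) * P
  A+V≤[1+ρ]P N = begin
    A N + V N         ≤⟨ ℚP.+-mono-≤ (proj₁ A-sup N) (V≤ρP N) ⟩
    P + ρ * P         ≡⟨ cong (_+ ρ * P) (sym (ℚP.*-identityˡ P)) ⟩
    1ℚ * P + ρ * P    ≡⟨ sym (ℚP.*-distribʳ-+ P 1ℚ ρ) ⟩
    (1ℚ + ρ) * P      ∎

  -- Because ρ P = ρ (ρ P) + c P, the gap ρ P − V N at least halves, up to δ, as N is multiplied by k.
  ρP-gap-*k : ∀ {N η δ} → 0ℚ ≤ η → 0ℚ ≤ δ → ρ * P ≤ V N + η → P ≤ A N + δ →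
              ρ * P ≤ V (N ℕ.* k) + (½ * η + ½ * δ)
  ρP-gap-*k {N} {η} {δ} 0≤η 0≤δ ρP≤V+η P≤A+δ = begin
    ρ * P                                    ≡⟨ cong (_* P) (sym c+ρ²≡ρ) ⟩
    (c + ρ * ρ) * P                          ≡⟨ regroup c ρ P ⟩
    ρ * (ρ * P) + c * P                      ≤⟨ ℚP.+-mono-≤ (*-monoˡ-≤-0≤ 0≤ρ ρP≤V+η) (*-monoˡ-≤-0≤ 0≤c P≤A+δ) ⟩
    ρ * (V N + η) + c * (A N + δ)            ≡⟨ distribute ρ c (V N) (A N) η δ ⟩
    (ρ * V N + c * A N) + (ρ * η + c * δ)    ≡⟨ cong (_+ (ρ * η + c * δ)) (sym (V-*k N)) ⟩
    V (N ℕ.* k) + (ρ * η + c * δ)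
      ≤⟨ ℚP.+-monoʳ-≤ (V (N ℕ.* k)) (ℚP.+-mono-≤ (*-monoʳ-≤-0≤ 0≤η ρ≤½) (*-monoʳ-≤-0≤ 0≤δ c≤½)) ⟩
    V (N ℕ.* k) + (½ * η + ½ * δ)            ∎
    where
    regroup : ∀ c ρ P → (c + ρ * ρ) * P ≡ ρ * (ρ * P) + c * P
    regroup = solve 3 (λ c ρ P → (c :+ ρ :* ρ) :* P := ρ :* (ρ :* P) :+ c :* P) refl
    distribute : ∀ ρ c v a η δ → ρ * (v + η) + c * (a + δ) ≡ (ρ * v + c * a) + (ρ * η + c * δ)
    distribute = solve 6 (λ ρ c v a η δ → ρ :* (v :+ η) :+ c :* (a :+ δ) := (ρ :* v :+ c :* a) :+ (ρ :* η :+ c :* δ)) refl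

  A+V-approaches : ∀ ε → 0ℚ < ε → ∃ λ N → (1ℚ + ρ) * P < (A N + V N) + ε
  A+V-approaches ε 0<ε = iterate K , (begin-strict
    (1ℚ + ρ) * P                             ≡⟨ trans (ℚP.*-distribʳ-+ P 1ℚ ρ) (cong (_+ ρ * P) (ℚP.*-identityˡ P)) ⟩
    P + ρ * P
      <⟨ ℚP.+-mono-<-≤ (P<A+δ K) (ℚP.<⇒≤ (ℚP.≤-<-trans (ρP-gap K) (ℚP.+-monoʳ-< (V (iterate K)) (ℚP.+-monoʳ-< δ B/[K+1]<δ)))) ⟩
    (A (iterate K) + δ) + (V (iterate K) + (δ + δ))  ≡⟨ regroup (A (iterate K)) (V (iterate K)) δ ⟩
    (A (iterate K) + V (iterate K)) + (δ + δ + δ)    ≡⟨ cong (_+_ (A (iterate K) + V (iterate K))) thirds ⟩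
    (A (iterate K) + V (iterate K)) + ε      ∎)
    where
    δ : ℚ
    δ = 1/ₙ 3 * ε
    0<δ : 0ℚ < δ
    0<δ = subst (_< δ) (ℚP.*-zeroˡ ε) (ℚP.*-monoˡ-<-pos ε {{ℚ.positive 0<ε}} (0<1/ₙ 3))
    0≤δ : 0ℚ ≤ δ
    0≤δ = ℚP.<⇒≤ 0<δ
    thirds : δ + δ + δ ≡ ε
    thirds = trans (solve 2 (λ t ε → t :* ε :+ t :* ε :+ t :* ε := (t :+ t :+ t) :* ε) refl (1/ₙ 3) ε) (ℚP.*-identityˡ ε)
    regroup : ∀ a v δ → (a + δ) + (v + (δ + δ)) ≡ (a + v) + (δ + δ + δ)
    regroup = solve 3 (λ a v δ → (a :+ δ) :+ (v :+ (δ :+ δ)) := (a :+ v) :+ (δ :+ δ :+ δ)) refl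

    M₀ = proj₁ (proj₂ A-sup δ 0<δ)
    B  = proj₁ (≤-fromℕ (ρ * P))
    K  = proj₁ (archimedean B 0<δ)
    B/[K+1]<δ : fromℕ B * 1/ₙ (suc K) < δ
    B/[K+1]<δ = proj₂ (archimedean B 0<δ)

    iterate : ℕ → ℕ
    iterate zero    = M₀
    iterate (suc K) = iterate K ℕ.* k

    M₀≤iterate : ∀ K → M₀ ℕ.≤ iterate K
    M₀≤iterate zero    = ℕP.≤-refl
    M₀≤iterate (suc K) = ℕP.≤-trans (M₀≤iterate K) (ℕP.m≤m*n (iterate K) k)

    P<A+δ : ∀ K → P < A (iterate K) + δ
    P<A+δ K = ℚP.<-≤-trans (proj₂ (proj₂ A-sup δ 0<δ)) (ℚP.+-monoˡ-≤ δ (A-mono (M₀≤iterate K)))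

    ρP-gap : ∀ K → ρ * P ≤ V (iterate K) + (δ + fromℕ B * 1/ₙ (suc K))
    ρP-gap zero = begin
      ρ * P                             ≤⟨ proj₂ (≤-fromℕ (ρ * P)) ⟩
      fromℕ B                           ≡⟨ sym (ℚP.*-identityʳ (fromℕ B)) ⟩
      fromℕ B * 1/ₙ 1                   ≤⟨ ≤-+ʳ {fromℕ B * 1/ₙ 1} 0≤δ ⟩
      fromℕ B * 1/ₙ 1 + δ               ≡⟨ ℚP.+-comm (fromℕ B * 1/ₙ 1) δ ⟩
      δ + fromℕ B * 1/ₙ 1               ≤⟨ subst (_≤ V M₀ + (δ + fromℕ B * 1/ₙ 1)) (ℚP.+-identityˡ _)
                                             (ℚP.+-monoˡ-≤ (δ + fromℕ B * 1/ₙ 1) (0≤V M₀)) ⟩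
      V M₀ + (δ + fromℕ B * 1/ₙ 1)      ∎
    ρP-gap (suc K) = ℚP.≤-trans
      (ρP-gap-*k (ℚP.+-mono-≤ 0≤δ (0≤* (0≤fromℕ B) (0≤1/ₙ (suc K)))) 0≤δ (ρP-gap K) (ℚP.<⇒≤ (P<A+δ K)))
      (ℚP.+-monoʳ-≤ (V (iterate (suc K))) (½-contraction B K δ (0≤fromℕ B)))

  isSupremum : IsSupremum (λ N → A N + V N) ((1ℚ + ρ) * P)
  isSupremum = A+V≤[1+ρ]P , A+V-approaches

IsSupremum-cong : ∀ {s t L} → (∀ N → s N ≡ t N) → IsSupremum s L → IsSupremum t L
IsSupremum-cong s≗t (s≤L , L<s+ε) =
    (λ N → subst (_≤ _) (s≗t N) (s≤L N))
  , (λ ε 0<ε → let (N , L<sN+ε) = L<s+ε ε 0<ε in N , subst (λ x → _ < x + ε) (s≗t N) L<sN+ε)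

eulerFactorOf : List ℕ → ℚ
eulerFactorOf ps = prodℚ (map (λ p → + p / suc p) ps)

p/[1+p]*[1+1/p]≡1 : ∀ p .{{_ : ℕ.NonZero p}} → + p / suc p * (1ℚ + 1/ₙ p) ≡ 1ℚ
p/[1+p]*[1+1/p]≡1 p = begin
  + p / suc p * (1ℚ + 1/ₙ p)                          ≡⟨ cong₂ _*_ (/-≡-*-1/ₙ p (suc p)) 1+1/p≡[1+p]/p ⟩
  (fromℕ p * 1/ₙ suc p) * (fromℕ (suc p) * 1/ₙ p)     ≡⟨ swap (fromℕ p) (1/ₙ suc p) (fromℕ (suc p)) (1/ₙ p) ⟩
  (fromℕ p * 1/ₙ p) * (fromℕ (suc p) * 1/ₙ suc p)     ≡⟨ cong₂ _*_ (fromℕ-*-1/ₙ p) (fromℕ-*-1/ₙ (suc p)) ⟩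
  1ℚ                                                  ∎
  where
  open ≡-Reasoning
  open +-*-Solver
  swap : ∀ a b c d → (a * b) * (c * d) ≡ (a * d) * (c * b)
  swap = solve 4 (λ a b c d → (a :* b) :* (c :* d) := (a :* d) :* (c :* b)) refl
  1+1/p≡[1+p]/p : 1ℚ + 1/ₙ p ≡ fromℕ (suc p) * 1/ₙ p
  1+1/p≡[1+p]/p = begin
    1ℚ + 1/ₙ p                        ≡⟨ cong₂ _+_ (sym (fromℕ-*-1/ₙ p)) (sym (ℚP.*-identityˡ (1/ₙ p))) ⟩
    fromℕ p * 1/ₙ p + 1ℚ * 1/ₙ p      ≡⟨ sym (ℚP.*-distribʳ-+ (1/ₙ p) (fromℕ p) 1ℚ) ⟩
    (fromℕ p + 1ℚ) * 1/ₙ p            ≡⟨ cong (_* 1/ₙ p) (sym (fromℕ-suc p)) ⟩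
    fromℕ (suc p) * 1/ₙ p             ∎

supportedSum-supremum : ∀ ps → All Prime ps → Unique ps →
                        ∃ λ P → IsSupremum (supportedSum ps) P × eulerFactorOf ps * P ≡ 1ℚ
supportedSum-supremum [] [] [] = 1ℚ , (≤1 , 1<1+ε) , refl
  where
  ≤1 : ∀ N → supportedSum [] N ≤ 1ℚ
  ≤1 zero    = ℚP.<⇒≤ (0<1/ₙ 1)
  ≤1 (suc N) = ℚP.≤-reflexive (supportedSum-[] N)
  1<1+ε : ∀ ε → 0ℚ < ε → ∃ λ N → 1ℚ < supportedSum [] N + ε
  1<1+ε ε 0<ε = 1 , subst (_< 1ℚ + ε) (ℚP.+-identityʳ 1ℚ) (ℚP.+-monoʳ-< 1ℚ 0<ε)
supportedSum-supremum (p ∷ qs) (pp ∷ qs-prime) (p∉qs ∷ qs-unique)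
  with supportedSum-supremum qs qs-prime qs-unique
... | P , P-sup , E*P≡1 = (1ℚ + 1/ₙ p) * P , IsSupremum-cong (sym ∘ supportedSum-∷ pp p∉qs′) self-similar , E′*P′≡1
  where
  instance _ = prime⇒nonZero pp
  instance _ = prime⇒nonTrivial pp
  p∉qs′ : p ∉ qs
  p∉qs′ = All¬⇒¬Any p∉qs
  self-similar : IsSupremum (λ N → supportedSum qs N + divisibleSum pp p∉qs′ N) ((1ℚ + 1/ₙ p) * P)
  self-similar = SelfSimilar.isSupremum p (supportedSum-mono qs)
    (λ N → divisibleSum-mono pp p∉qs′ {0} {N} z≤n)
    (divisibleSum-mono pp p∉qs′) (divisibleSum-*p pp p∉qs′)
    (0≤1/ₙ p) (1/ₙ-antimono (ℕ.nonTrivial⇒n>1 p)) (0≤term p) (term-prime+1/p² pp) P-sup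
  E′*P′≡1 : eulerFactorOf (p ∷ qs) * ((1ℚ + 1/ₙ p) * P) ≡ 1ℚ
  E′*P′≡1 = begin
    (+ p / suc p * eulerFactorOf qs) * ((1ℚ + 1/ₙ p) * P)   ≡⟨ interchange (+ p / suc p) (eulerFactorOf qs) (1ℚ + 1/ₙ p) P ⟩
    (+ p / suc p * (1ℚ + 1/ₙ p)) * (eulerFactorOf qs * P)   ≡⟨ cong₂ _*_ (p/[1+p]*[1+1/p]≡1 p) E*P≡1 ⟩
    1ℚ                                                      ∎
    where
    open ≡-Reasoning
    open +-*-Solver
    interchange : ∀ a b c d → (a * b) * (c * d) ≡ (a * c) * (b * d)
    interchange = solve 4 (λ a b c d → (a :* b) :* (c :* d) := (a :* c) :* (b :* d)) refl

∣-pos : ∀ {e x} → 1 ℕ.≤ x → e ∣ x → 1 ℕ.≤ e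
∣-pos {zero}  1≤x 0∣x = contradiction (0∣⇒≡0 0∣x) (ℕP.>⇒≢ 1≤x)
∣-pos {suc _} _   _   = s≤s z≤n

module _ {n d} .{{_ : ℕ.NonZero n}} .{{_ : ℕ.NonZero d}} where

  admissible⁻ : ∀ {d′ q} → 1 ℕ.≤ d′ → Admissible n d d′ → Prime q → q ∣ d′ → q ∣ d × ¬ q ∣ (n ℕ./ d)
  admissible⁻ 1≤d′ adm pq q∣d′ = All.lookup adm (∈-primeDivisors⁺ 1≤d′ pq q∣d′)

  admissible⁺ : ∀ {d′} → (∀ {q} → Prime q → q ∣ d′ → q ∣ d × ¬ q ∣ (n ℕ./ d)) → Admissible n d d′
  admissible⁺ factors-ok = All.tabulate (λ q∈ → let (pq , q∣d′) = ∈-primeDivisors⁻ q∈ in factors-ok pq q∣d′)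

  private
    1≤m/d : ∀ {m} → 1 ℕ.≤ m → d ∣ m → 1 ℕ.≤ m ℕ./ d
    1≤m/d 1≤m d∣m = m≥n⇒m/n>0 (∣⇒≤ {{ℕ.>-nonZero 1≤m}} d∣m)

    ∣m/d⇒∣m : ∀ {q m} → d ∣ m → q ∣ m ℕ./ d → q ∣ m
    ∣m/d⇒∣m d∣m q∣m/d = subst (_ ∣_) (m/n*n≡m d∣m) (∣m⇒∣m*n d q∣m/d)

    gcd≡d*gcd[/d] : ∀ {m} → d ∣ m → d ∣ n → gcd m n ≡ d ℕ.* gcd (m ℕ./ d) (n ℕ./ d)
    gcd≡d*gcd[/d] {m} d∣m d∣n = trans
      (cong₂ gcd (trans (sym (m/n*n≡m d∣m)) (ℕP.*-comm (m ℕ./ d) d)) (trans (sym (m/n*n≡m d∣n)) (ℕP.*-comm (n ℕ./ d) d)))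
      (sym (c*gcd[m,n]≡gcd[cm,cn] d (m ℕ./ d) (n ℕ./ d)))

  admissible⇒≡gcd : ∀ {m} → 1 ℕ.≤ m → d ∣ n → d ∣ m → Admissible n d (m ℕ./ d) → d ≡ gcd m n
  admissible⇒≡gcd {m} 1≤m d∣n d∣m adm = sym (begin
    gcd m n                                ≡⟨ gcd≡d*gcd[/d] d∣m d∣n ⟩
    d ℕ.* gcd (m ℕ./ d) (n ℕ./ d)          ≡⟨ cong (d ℕ.*_) (coprime⇒gcd≡1 m/d⊥n/d) ⟩
    d ℕ.* 1                                ≡⟨ ℕP.*-identityʳ d ⟩
    d                                      ∎)
    where
    open ≡-Reasoning
    m/d⊥n/d : Coprime (m ℕ./ d) (n ℕ./ d)
    m/d⊥n/d {e} (e∣m/d , e∣n/d) with e ℕ.≟ 1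
    ... | yes e≡1 = e≡1
    ... | no e≢1 with prime-factor e (∣-pos (1≤m/d 1≤m d∣m) e∣m/d) e≢1
    ... | q , pq , q∣e = contradiction (∣-trans q∣e e∣n/d)
                           (proj₂ (admissible⁻ (1≤m/d 1≤m d∣m) adm pq (∣-trans q∣e e∣m/d)))

  admissible⇒supportedIn : ∀ {m} → 1 ℕ.≤ m → d ∣ n → d ∣ m → Admissible n d (m ℕ./ d) →
                           SupportedIn (primeDivisors n) m
  admissible⇒supportedIn {m} 1≤m d∣n d∣m adm = supportedIn⁺ {m = m} λ {q} pq q∣m →
    ∈-primeDivisors⁺ (ℕ.>-nonZero⁻¹ n) pq
      (divides-n pq (euclidsLemma (m ℕ./ d) d pq (subst (q ∣_) (sym (m/n*n≡m d∣m)) q∣m)))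
    where
    divides-n : ∀ {q} → Prime q → q ∣ m ℕ./ d ⊎ q ∣ d → q ∣ n
    divides-n pq (inj₁ q∣m/d) = ∣-trans (proj₁ (admissible⁻ (1≤m/d 1≤m d∣m) adm pq q∣m/d)) d∣n
    divides-n pq (inj₂ q∣d)   = ∣-trans q∣d d∣n

  ≡gcd⇒admissible : ∀ {m} → 1 ℕ.≤ m → SupportedIn (primeDivisors n) m → d ≡ gcd m n →
                    d ∣ m × Admissible n d (m ℕ./ d)
  ≡gcd⇒admissible {m} 1≤m m∈n d≡gcd = d∣m , admissible⁺ factors-ok
    where
    d∣m : d ∣ m
    d∣m = subst (_∣ m) (sym d≡gcd) (gcd[m,n]∣m m n)
    d∣n : d ∣ n
    d∣n = subst (_∣ n) (sym d≡gcd) (gcd[m,n]∣n m n)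
    m/d⊥n/d : Coprime (m ℕ./ d) (n ℕ./ d)
    m/d⊥n/d = gcd≡1⇒coprime (ℕP.*-cancelˡ-≡ _ 1 d
      (trans (sym (gcd≡d*gcd[/d] d∣m d∣n)) (trans (sym d≡gcd) (sym (ℕP.*-identityʳ d)))))
    factors-ok : ∀ {q} → Prime q → q ∣ m ℕ./ d → q ∣ d × ¬ q ∣ (n ℕ./ d)
    factors-ok {q} pq q∣m/d =
        subst (q ∣_) (sym d≡gcd) (gcd-greatest q∣m (proj₂ (∈-primeDivisors⁻ (supportedIn⁻ 1≤m m∈n pq q∣m))))
      , λ q∣n/d → prime≢1 pq (m/d⊥n/d (q∣m/d , q∣n/d))
      where
      q∣m : q ∣ m
      q∣m = ∣m/d⇒∣m d∣m q∣m/d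

-- The summand of Z(d,1) reindexed by m = d′d (junk 0 at d = 0).
Zterm : ℕ → ℕ → ℕ → ℚ
Zterm n zero      m = 0ℚ
Zterm n d@(suc _) m = when (d ∣? m) (when (admissible? n d (m ℕ./ d)) (term m))

0≤Zterm : ∀ n d m → 0ℚ ≤ Zterm n d m
0≤Zterm n zero      m = ℚP.≤-refl
0≤Zterm n d@(suc _) m = 0≤when (d ∣? m) (0≤when (admissible? n d (m ℕ./ d)) (0≤term m))

Zpartial≡∑Zterm : ∀ n d .{{_ : ℕ.NonZero d}} N → Zpartial n d N ≡ ∑ (Zterm n d) (range1 (N ℕ.* d))
Zpartial≡∑Zterm n d@(suc _) N = begin
  Zpartial n d N
    ≡⟨ sumℚ-map (λ d′ → term (d′ ℕ.* d)) (filter (admissible? n d) (range1 N)) ⟩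
  ∑ (λ d′ → term (d′ ℕ.* d)) (filter (admissible? n d) (range1 N))
    ≡⟨ ℚSum.∑-filter (admissible? n d) _ (range1 N) ⟩
  ∑ (λ d′ → when (admissible? n d d′) (term (d′ ℕ.* d))) (range1 N)
    ≡⟨ ℚSum.∑-cong (range1 N) (λ {d′} _ → cong (λ x → when (admissible? n d x) (term (d′ ℕ.* d))) (sym (m*n/n≡m d′ d))) ⟩
  ∑ (λ d′ → when (admissible? n d ((d′ ℕ.* d) ℕ./ d)) (term (d′ ℕ.* d))) (range1 N)
    ≡⟨ sym (ℚSum.∑-multiples d (λ m → when (admissible? n d (m ℕ./ d)) (term m)) N) ⟩
  ∑ (Zterm n d) (range1 (N ℕ.* d)) ∎
  where open ≡-Reasoning

module _ (n : ℕ) .{{_ : ℕ.NonZero n}} where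

  private
    ps = primeDivisors n

  ∈-divisors⁻ : ∀ {d} → d ∈ divisors n → 1 ℕ.≤ d × d ℕ.≤ n × d ∣ n
  ∈-divisors⁻ d∈ = let (d∈range , d∣n) = ∈-filter⁻ (_∣? n) {xs = range1 n} d∈
                   in proj₁ (∈-range1⁻ n d∈range) , proj₂ (∈-range1⁻ n d∈range) , d∣n

  gcd∈divisors : ∀ m → gcd m n ∈ divisors n
  gcd∈divisors m = ∈-filter⁺ (_∣? n)
    (∈-range1⁺ n (∣-pos (ℕ.>-nonZero⁻¹ n) (gcd[m,n]∣n m n)) (gcd[m,n]≤n m n)) (gcd[m,n]∣n m n)

  private
    when-gcd≡0 : ∀ {m d} .{{_ : ℕ.NonZero d}} → 1 ℕ.≤ m → ¬ (d ∣ m × Admissible n d (m ℕ./ d)) →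
                 when (d ℕ.≟ gcd m n) (when (supportedIn? ps m) (term m)) ≡ 0ℚ
    when-gcd≡0 {m} {d} 1≤m ¬ok with d ℕ.≟ gcd m n
    ... | no _      = refl
    ... | yes d≡gcd = ℚSum.when-no (supportedIn? ps m) (λ m∈ → ¬ok (≡gcd⇒admissible 1≤m m∈ d≡gcd))

  Zterm≡when-gcd : ∀ {m d} → 1 ℕ.≤ m → d ∈ divisors n →
                   Zterm n d m ≡ when (d ℕ.≟ gcd m n) (when (supportedIn? ps m) (term m))
  Zterm≡when-gcd {m} {d} 1≤m d∈ with ∈-divisors⁻ d∈
  Zterm≡when-gcd {m} {d@(suc _)} 1≤m d∈ | _ , _ , d∣n with d ∣? m | admissible? n d (m ℕ./ d)
  ... | yes d∣m | yes adm = sym (trans (ℚSum.when-yes (d ℕ.≟ gcd m n) (admissible⇒≡gcd 1≤m d∣n d∣m adm))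
                                       (ℚSum.when-yes (supportedIn? ps m) (admissible⇒supportedIn 1≤m d∣n d∣m adm)))
  ... | yes _   | no ¬adm = sym (when-gcd≡0 1≤m (¬adm ∘ proj₂))
  ... | no d∤m  | _       = sym (when-gcd≡0 1≤m (d∤m ∘ proj₁))

  ∑-divisors-Zterm : ∀ {m} → 1 ℕ.≤ m → ∑ (λ d → Zterm n d m) (divisors n) ≡ when (supportedIn? ps m) (term m)
  ∑-divisors-Zterm {m} 1≤m = trans (ℚSum.∑-cong (divisors n) (Zterm≡when-gcd 1≤m))
    (ℚSum.∑-when-≡-unique ℕ._≟_ (divisors n) (UniqueP.filter⁺ (_∣? n) (range1-unique n)) (gcd∈divisors m))

  supportedSum≡∑-divisors : ∀ X → supportedSum ps X ≡ ∑ (λ d → ∑ (Zterm n d) (range1 X)) (divisors n)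
  supportedSum≡∑-divisors X =
    trans (ℚSum.∑-cong (range1 X) (λ m∈ → sym (∑-divisors-Zterm (proj₁ (∈-range1⁻ X m∈)))))
          (ℚSum.∑-swap (λ m d → Zterm n d m) (range1 X) (divisors n))

  ∑Zpartial : ℕ → ℚ
  ∑Zpartial N = ∑ (λ d → Zpartial n d N) (divisors n)

  ∑Zpartial≡ : ∀ N → ∑Zpartial N ≡ ∑ (λ d → ∑ (Zterm n d) (range1 (N ℕ.* d))) (divisors n)
  ∑Zpartial≡ N = ℚSum.∑-cong (divisors n) λ d∈ →
    Zpartial≡∑Zterm n _ {{ℕ.>-nonZero (proj₁ (∈-divisors⁻ d∈))}} N

  supportedSum≤∑Zpartial : ∀ N → supportedSum ps N ≤ ∑Zpartial N
  supportedSum≤∑Zpartial N = begin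
    supportedSum ps N                                         ≡⟨ supportedSum≡∑-divisors N ⟩
    ∑ (λ d → ∑ (Zterm n d) (range1 N)) (divisors n)           ≤⟨ ∑-mono (divisors n) (λ {d} d∈ →
        ∑-range1-mono (Zterm n d) (0≤Zterm n d) (ℕP.m≤m*n N d {{ℕ.>-nonZero (proj₁ (∈-divisors⁻ d∈))}})) ⟩
    ∑ (λ d → ∑ (Zterm n d) (range1 (N ℕ.* d))) (divisors n)   ≡⟨ sym (∑Zpartial≡ N) ⟩
    ∑Zpartial N                                               ∎
    where open ℚP.≤-Reasoning

  ∑Zpartial≤supportedSum : ∀ N → ∑Zpartial N ≤ supportedSum ps (N ℕ.* n)
  ∑Zpartial≤supportedSum N = begin
    ∑Zpartial N                                               ≡⟨ ∑Zpartial≡ N ⟩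
    ∑ (λ d → ∑ (Zterm n d) (range1 (N ℕ.* d))) (divisors n)   ≤⟨ ∑-mono (divisors n) (λ {d} d∈ →
        ∑-range1-mono (Zterm n d) (0≤Zterm n d) (ℕP.*-monoʳ-≤ N (proj₁ (proj₂ (∈-divisors⁻ d∈))))) ⟩
    ∑ (λ d → ∑ (Zterm n d) (range1 (N ℕ.* n))) (divisors n)   ≡⟨ sym (supportedSum≡∑-divisors (N ℕ.* n)) ⟩
    supportedSum ps (N ℕ.* n)                                 ∎
    where open ℚP.≤-Reasoning

  Rpartial≡ : ∀ N → Rpartial n N ≡ eulerFactor n * ∑Zpartial N
  Rpartial≡ N = begin
    Rpartial n N                                              ≡⟨ sumℚ-map (λ d → Zpartial n d N * eulerFactor n) (divisors n) ⟩
    ∑ (λ d → Zpartial n d N * eulerFactor n) (divisors n)     ≡⟨ ℚSum.∑-cong (divisors n) (λ _ → ℚP.*-comm _ (eulerFactor n)) ⟩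
    ∑ (λ d → eulerFactor n * Zpartial n d N) (divisors n)     ≡⟨ sym (∑-*ˡ (eulerFactor n) (λ d → Zpartial n d N) (divisors n)) ⟩
    eulerFactor n * ∑Zpartial N                               ∎
    where open ≡-Reasoning

0<* : ∀ {a b} → 0ℚ < a → 0ℚ < b → 0ℚ < a * b
0<* {a} {b} 0<a 0<b = subst (_< a * b) (ℚP.*-zeroˡ b) (ℚP.*-monoˡ-<-pos b {{ℚ.positive 0<b}} 0<a)

0<eulerFactorOf : ∀ {ps} → All Prime ps → 0ℚ < eulerFactorOf ps
0<eulerFactorOf []                      = 0<1/ₙ 1
0<eulerFactorOf {suc p′ ∷ _} (_ ∷ prime) = 0<* 0<p/[1+p] (0<eulerFactorOf prime)
  where
  0<p/[1+p] : 0ℚ < + suc p′ / suc (suc p′)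
  0<p/[1+p] = <-via-ℚᵘ ℚᵘP.≃-refl (toℚᵘ-/ (suc p′) (suc p′)) (*<* (ℤ.+<+ (s≤s z≤n)))
0<eulerFactorOf {zero ∷ _} (p0 ∷ _) = contradiction p0 ¬prime[0]

IsSupremum-*ˡ : ∀ {s L c} → 0ℚ < c → IsSupremum s L → IsSupremum (λ N → c * s N) (c * L)
IsSupremum-*ˡ {s} {L} {c} 0<c (s≤L , L<s+ε) = (λ N → *-monoˡ-≤-0≤ (ℚP.<⇒≤ 0<c) (s≤L N)) , cL<cs+ε
  where
  instance _ = ℚP.pos⇒nonZero c {{ℚ.positive 0<c}}
  cL<cs+ε : ∀ ε → 0ℚ < ε → ∃ λ N → c * L < c * s N + ε
  cL<cs+ε ε 0<ε = N , (begin-strict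
    c * L                      <⟨ ℚP.*-monoʳ-<-pos c {{ℚ.positive 0<c}} L<sN+ε/c ⟩
    c * (s N + ε * ℚ.1/ c)     ≡⟨ ℚP.*-distribˡ-+ c (s N) _ ⟩
    c * s N + c * (ε * ℚ.1/ c) ≡⟨ cong (_+_ (c * s N)) c*[ε/c]≡ε ⟩
    c * s N + ε                ∎)
    where
    open ℚP.≤-Reasoning
    0<1/c : 0ℚ < ℚ.1/ c
    0<1/c = ℚP.positive⁻¹ _ {{ℚP.1/pos⇒pos c {{ℚ.positive 0<c}}}}
    N = proj₁ (L<s+ε (ε * ℚ.1/ c) (0<* 0<ε 0<1/c))
    L<sN+ε/c = proj₂ (L<s+ε (ε * ℚ.1/ c) (0<* 0<ε 0<1/c))
    c*[ε/c]≡ε : c * (ε * ℚ.1/ c) ≡ ε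
    c*[ε/c]≡ε = begin-equality
      c * (ε * ℚ.1/ c)  ≡⟨ cong (c *_) (ℚP.*-comm ε _) ⟩
      c * (ℚ.1/ c * ε)  ≡⟨ sym (ℚP.*-assoc c _ ε) ⟩
      (c * ℚ.1/ c) * ε  ≡⟨ cong (_* ε) (ℚP.*-inverseʳ c) ⟩
      1ℚ * ε            ≡⟨ ℚP.*-identityˡ ε ⟩
      ε                 ∎

∣x-L∣<ε : ∀ {x L ε} → x ≤ L → L < x + ε → ℚ.∣ x - L ∣ < ε
∣x-L∣<ε {x} {L} {ε} x≤L L<x+ε = begin-strict
  ℚ.∣ x - L ∣      ≡⟨ trans (sym (ℚP.∣-p∣≡∣p∣ (x - L))) (cong ℚ.∣_∣ (neg-diff x L)) ⟩
  ℚ.∣ L - x ∣      ≡⟨ ℚP.0≤p⇒∣p∣≡p (subst (_≤ L - x) (ℚP.+-inverseʳ x) (ℚP.+-monoˡ-≤ (- x) x≤L)) ⟩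
  L - x            <⟨ ℚP.+-monoˡ-< (- x) L<x+ε ⟩
  x + ε - x        ≡⟨ cancel x ε ⟩
  ε                ∎
  where
  open ℚP.≤-Reasoning
  open +-*-Solver
  neg-diff : ∀ x L → - (x - L) ≡ L - x
  neg-diff = solve 2 (λ x L → :- (x :- L) := L :- x) refl
  cancel : ∀ x ε → x + ε - x ≡ ε
  cancel = solve 2 (λ x ε → x :+ ε :- x := ε) refl

squeeze : ∀ {s t L} → (∀ {M N} → M ℕ.≤ N → s M ≤ s N) → IsSupremum s L →
          (∀ N → s N ≤ t N) → (∀ N → t N ≤ L) → ConvergesTo t L
squeeze {s} {t} {L} s-mono (_ , L<s+ε) s≤t t≤L ε 0<ε = N₀ , λ M N₀≤M →
  ∣x-L∣<ε (t≤L M) (ℚP.<-≤-trans L<sN₀+ε (ℚP.+-monoˡ-≤ ε (ℚP.≤-trans (s-mono N₀≤M) (s≤t M))))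
  where
  N₀ = proj₁ (L<s+ε ε 0<ε)
  L<sN₀+ε = proj₂ (L<s+ε ε 0<ε)

lemma8p4 : (n : ℕ) → n ≥ 1 → ConvergesTo (Rpartial n) 1ℚ
lemma8p4 n@(suc _) _ = squeeze
  (λ M≤N → *-monoˡ-≤-0≤ 0≤E (supportedSum-mono ps M≤N))
  (subst (IsSupremum _) E*P≡1 (IsSupremum-*ˡ 0<E P-sup))
  (λ N → subst (eulerFactor n * supportedSum ps N ≤_) (sym (Rpartial≡ n N)) (*-monoˡ-≤-0≤ 0≤E (supportedSum≤∑Zpartial n N)))
  (λ N → subst₂ _≤_ (sym (Rpartial≡ n N)) E*P≡1
           (*-monoˡ-≤-0≤ 0≤E (ℚP.≤-trans (∑Zpartial≤supportedSum n N) (proj₁ P-sup (N ℕ.* n)))))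
  where
  ps = primeDivisors n
  ps-prime : All Prime ps
  ps-prime = All.tabulate (proj₁ ∘ ∈-primeDivisors⁻ {m = n})
  supremum = supportedSum-supremum ps ps-prime (UniqueP.filter⁺ (λ p → prime? p ×-dec (p ∣? n)) (range1-unique n))
  P = proj₁ supremum
  P-sup = proj₁ (proj₂ supremum)
  E*P≡1 : eulerFactor n * P ≡ 1ℚ
  E*P≡1 = proj₂ (proj₂ supremum)
  0<E = 0<eulerFactorOf ps-prime
  0≤E = ℚP.<⇒≤ 0<E
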